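{- For all integers $n\ge0$ and $k\ge j\ge0$, \begin{align*} \bar{a}_{3(k-j)+3,\, 3k+6}(3n+1)&\equiv 0 \pmod 3,\\ \bar{a}_{3(k-j)+3,\, 3k+6}(3n+2)&\equiv 0 \pmod 3,\\ \bar{a}_{3(k-j)+5,\, 3k+1}(3n+2)&\equiv 0 \pmod 3. \end{align*}
   Context: For $m\ge1$ let $f_m:=\prod_{k=1}^{\infty}(1-q^{mk})$. For integers $r,s\ge1$, $\bar{a}_{r,s}(n)$ denotes the number of overpartitions of $n$ (partitions in which the first occurrence of each part size may be overlined) wherein each even part may appear in one of $r$ colors and each odd part in one of $s$ colors; its generating function is \[ \sum_{n=0}^{\infty}\bar{a}_{r,s}(n)q^n=\frac{f_2^{3s-2r}}{f_1^{2s}f_4^{s-r}}. \] -}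

module Defs where

open import Data.Nat as ℕ using (ℕ; zero; suc; _∸_)
open import Data.Nat.Divisibility using (_∣?_)
open import Data.Integer as ℤ using (ℤ; +_; -[1+_]; _+_; _*_; _-_; -_)
open import Relation.Nullary.Decidable using (⌊_⌋)
open import Data.Bool using (if_then_else_)

Series : Set
Series = ℕ → ℤ

sumTo : ℕ → (ℕ → ℤ) → ℤ
sumTo zero    g = g 0
sumTo (suc n) g = sumTo n g + g (suc n)

_⊛_ : Series → Series → Series
(a ⊛ b) n = sumTo n (λ i → a i * b (n ∸ i))

oneS : Series
oneS zero    = + 1
oneS (suc _) = + 0

powS : Series → ℕ → Series
powS a zero    = oneS
powS a (suc e) = a ⊛ powS a e

-- the polynomial 1 - q^d   (d ≥ 1)
oneMinus : ℕ → Series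
oneMinus d n =
  if ⌊ n ℕ.≟ 0 ⌋ then + 1 else (if ⌊ n ℕ.≟ d ⌋ then -[1+ 0 ] else + 0)

-- the series 1/(1 - q^d) = Σ_{t≥0} q^{dt}   (d ≥ 1)
geomInv : ℕ → Series
geomInv d n = if ⌊ d ∣? n ⌋ then + 1 else + 0

prodTo : ℕ → (ℕ → Series) → Series
prodTo zero    F = oneS
prodTo (suc N) F = prodTo N F ⊛ F (suc N)

-- f_m = Π_{k≥1} (1 - q^{mk}); for m ≥ 1 its n-th coefficient is the n-th
-- coefficient of the finite product over k = 1..n.
f : ℕ → Series
f m n = prodTo n (λ k → oneMinus (m ℕ.* k)) n

fInv : ℕ → Series
fInv m n = prodTo n (λ k → geomInv (m ℕ.* k)) n

fPow : ℕ → ℤ → Series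
fPow m (+ e)     = powS (f m) e
fPow m -[1+ e ]  = powS (fInv m) (suc e)

-- Σ ā_{r,s}(n) q^n = f_2^{3s-2r} / ( f_1^{2s} f_4^{s-r} )
--                  = f_2^{3s-2r} · f_1^{-2s} · f_4^{r-s}
abar : ℕ → ℕ → Series
abar r s = (fPow 2 (ℤ.+ 3 * S - ℤ.+ 2 * R) ⊛ fPow 1 (- (ℤ.+ 2 * S))) ⊛ fPow 4 (R - S)
  where
  R S : ℤ
  R = + r
  S = + s

module Submission where

-- Modulo 3 the Frobenius congruence F³ ≡ F(q³) shows
-- that a power f_m^e with 3 ∣ e is congruent to a series in q³, and multiplying by such a series does
-- not change which residue classes of exponents carry coefficients divisible by 3.
--
-- For r = 3d+3, s = 3k+6 all three exponents are multiples of 3, so abar r s itself is congruent to a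
-- series in q³: its coefficients at 3n+1 and 3n+2 are divisible by 3.
--
-- For r = 3d+5, s = 3k+1 the exponents are ≡ 2, 1, 1 (mod 3), so abar r s is congruent to a series in
-- q³ times f₂² f₁ f₄ = f₂³ · ψ(-q), where ψ(-q) = f₁f₄/f₂ = Σ ± q^(m(m+1)/2) by Jacobi's identity.
-- Triangular numbers are never 2 modulo 3, so ψ(-q) has no terms q^(3n+2) at all.  The needed part of
-- Jacobi's identity comes from the Cauchy binomial theorem
--   ∏_{i<N} (y + x Qⁱ) = Σ_{a+b=N} Q^(a(a-1)/2) [N choose a]_Q xᵃ yᵇ
-- for Q = q⁴, x = -1, y = q^(4n+3), N = 2n+2: the left side is ±q^E (q;q²)_N, and multiplying by f₄
-- turns each Gaussian binomial into 1 up to the order min(a, b), while the exponents of the terms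
-- are E plus triangular numbers.

open import Defs renaming (_⊛_ to infixl 7 _⊛_)
open import Level using (0ℓ)
open import Function.Base using (_∘_)
open import Function.Bundles using (_⇔_; mk⇔; module Equivalence)
open import Data.Nat.Base using (ℕ; zero; suc; NonZero; _+_; _*_; _∸_; _≤_; _<_; _%_; z≤n; s≤s)
import Data.Nat.Properties as ℕP
import Data.Nat.Divisibility as ℕ∣
open import Data.Nat.DivMod using (%-remove-+ʳ; [m+n]%n≡m%n; [m+kn]%n≡m%n)
open import Data.Nat.Tactic.RingSolver using (solve-∀)
open import Data.Integer.Base as ℤ using (ℤ; +_; -[1+_]; +[1+_])
import Data.Integer.Properties as ℤP
import Data.Integer.Divisibility.Signed as Signed
open Signed using (divides; ∣m∣n⇒∣m+n; ∣n⇒∣m*n; ∣m⇒∣m*n)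
open import Data.Integer.Divisibility using (_∣_)
import Data.Integer.Tactic.RingSolver as ℤSolver
open import Data.Maybe.Base using (Maybe; just; nothing)
open import Data.Product.Base using (Σ-syntax; _×_; _,_)
open import Data.Sum.Base using (_⊎_; inj₁; inj₂)
open import Relation.Nullary.Decidable using (yes; no)
open import Relation.Nullary.Negation using (contradiction)
open import Relation.Binary.PropositionalEquality
  using (_≡_; _≢_; refl; sym; trans; cong; cong₂; subst; module ≡-Reasoning)
open import Relation.Binary.Structures using (IsEquivalence)
open import Relation.Binary.Bundles using (Setoid)
import Relation.Binary.Reasoning.Setoid
open import Algebra.Bundles using (CommutativeRing)
open import Algebra.Solver.Ring.AlmostCommutativeRing using (fromCommutativeRing; _-Raw-AlmostCommutative⟶_)
import Algebra.Solver.Ring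

-- The ring of formal power series

sumTo-cong : ∀ n {g h : ℕ → ℤ} → (∀ i → i ≤ n → g i ≡ h i) → sumTo n g ≡ sumTo n h
sumTo-cong zero    g≡h = g≡h 0 z≤n
sumTo-cong (suc n) g≡h =
  cong₂ ℤ._+_ (sumTo-cong n (λ i i≤n → g≡h i (ℕP.m≤n⇒m≤1+n i≤n))) (g≡h (suc n) ℕP.≤-refl)

sumTo-unfoldˡ : ∀ n (g : ℕ → ℤ) → sumTo (suc n) g ≡ g 0 ℤ.+ sumTo n (λ i → g (suc i))
sumTo-unfoldˡ zero    g = refl
sumTo-unfoldˡ (suc n) g =
  trans (cong (ℤ._+ g (suc (suc n))) (sumTo-unfoldˡ n g)) (ℤP.+-assoc (g 0) _ _)

sumTo-reverse : ∀ n (g : ℕ → ℤ) → sumTo n g ≡ sumTo n (λ i → g (n ∸ i))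
sumTo-reverse zero    g = refl
sumTo-reverse (suc n) g = begin
  sumTo n g ℤ.+ g (suc n)                  ≡⟨ cong (ℤ._+ g (suc n)) (sumTo-reverse n g) ⟩
  sumTo n (λ i → g (n ∸ i)) ℤ.+ g (suc n)  ≡⟨ ℤP.+-comm _ (g (suc n)) ⟩
  g (suc n) ℤ.+ sumTo n (λ i → g (n ∸ i))  ≡⟨ sumTo-unfoldˡ n (λ i → g (suc n ∸ i)) ⟨
  sumTo (suc n) (λ i → g (suc n ∸ i))      ∎
  where open ≡-Reasoning

sumTo-+ : ∀ n (g h : ℕ → ℤ) → sumTo n (λ i → g i ℤ.+ h i) ≡ sumTo n g ℤ.+ sumTo n h
sumTo-+ zero    g h = refl
sumTo-+ (suc n) g h =
  trans (cong (ℤ._+ (g (suc n) ℤ.+ h (suc n))) (sumTo-+ n g h))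
    (interchange (sumTo n g) (sumTo n h) (g (suc n)) (h (suc n)))
  where open import Algebra.Properties.CommutativeSemigroup ℤP.+-commutativeSemigroup using (interchange)

sumTo-*ˡ : ∀ n c (g : ℕ → ℤ) → sumTo n (λ i → c ℤ.* g i) ≡ c ℤ.* sumTo n g
sumTo-*ˡ zero    c g = refl
sumTo-*ˡ (suc n) c g =
  trans (cong (ℤ._+ (c ℤ.* g (suc n))) (sumTo-*ˡ n c g)) (sym (ℤP.*-distribˡ-+ c _ _))

sumTo-zero : ∀ n → sumTo n (λ _ → + 0) ≡ + 0
sumTo-zero zero    = refl
sumTo-zero (suc n) = cong (ℤ._+ + 0) (sumTo-zero n)

infix  4 _≈_
infixl 6 _⊕_ _⊖_
infix  8 ⊝_
infixr 7 _·_

record _≈_ (a b : Series) : Set where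
  constructor coeffwise
  field coeff : ∀ n → a n ≡ b n

open _≈_ public

_⊕_ : Series → Series → Series
(a ⊕ b) n = a n ℤ.+ b n

⊝_ : Series → Series
(⊝ a) n = ℤ.- a n

_⊖_ : Series → Series → Series
a ⊖ b = a ⊕ ⊝ b

-1ₛ : Series
-1ₛ = ⊝ oneS

_·_ : ℤ → Series → Series
(c · a) n = c ℤ.* a n

zeroS : Series
zeroS _ = + 0

constS : ℤ → Series
constS c zero    = c
constS c (suc _) = + 0

tail : Series → Series
tail a n = a (suc n)

⊛-suc : ∀ a b n → (a ⊛ b) (suc n) ≡ a 0 ℤ.* b (suc n) ℤ.+ (tail a ⊛ b) n
⊛-suc a b n = sumTo-unfoldˡ n (λ i → a i ℤ.* b (suc n ∸ i))

⊛-cong : ∀ {a a′ b b′} → a ≈ a′ → b ≈ b′ → a ⊛ b ≈ a′ ⊛ b′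
⊛-cong a≈a′ b≈b′ = coeffwise λ n →
  sumTo-cong n (λ i _ → cong₂ ℤ._*_ (coeff a≈a′ i) (coeff b≈b′ (n ∸ i)))

⊛-congˡ : ∀ a {b c} → b ≈ c → a ⊛ b ≈ a ⊛ c
⊛-congˡ a b≈c = ⊛-cong (coeffwise {a} λ _ → refl) b≈c

⊛-congʳ : ∀ c {a b} → a ≈ b → a ⊛ c ≈ b ⊛ c
⊛-congʳ c a≈b = ⊛-cong a≈b (coeffwise {c} λ _ → refl)

⊛-comm : ∀ a b → a ⊛ b ≈ b ⊛ a
⊛-comm a b = coeffwise λ n → trans (sumTo-reverse n _) (sumTo-cong n λ i i≤n →
  trans (ℤP.*-comm (a (n ∸ i)) _) (cong (λ j → b j ℤ.* a (n ∸ i)) (ℕP.m∸[m∸n]≡n i≤n)))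

⊛-distribʳ : ∀ c a b → (a ⊕ b) ⊛ c ≈ a ⊛ c ⊕ b ⊛ c
⊛-distribʳ c a b = coeffwise λ n →
  trans (sumTo-cong n (λ i _ → ℤP.*-distribʳ-+ (c (n ∸ i)) (a i) (b i))) (sumTo-+ n _ _)

⊛-distribˡ : ∀ c a b → c ⊛ (a ⊕ b) ≈ c ⊛ a ⊕ c ⊛ b
⊛-distribˡ c a b = coeffwise λ n →
  trans (sumTo-cong n (λ i _ → ℤP.*-distribˡ-+ (c i) (a (n ∸ i)) (b (n ∸ i)))) (sumTo-+ n _ _)

constS-⊛ : ∀ c a n → (constS c ⊛ a) n ≡ c ℤ.* a n
constS-⊛ c a zero    = refl
constS-⊛ c a (suc n) = begin
  (constS c ⊛ a) (suc n)                       ≡⟨ ⊛-suc (constS c) a n ⟩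
  c ℤ.* a (suc n) ℤ.+ (tail (constS c) ⊛ a) n  ≡⟨ cong (ℤ._+_ (c ℤ.* a (suc n))) zero-part ⟩
  c ℤ.* a (suc n) ℤ.+ + 0                      ≡⟨ ℤP.+-identityʳ _ ⟩
  c ℤ.* a (suc n)                              ∎
  where
  open ≡-Reasoning
  zero-part : (tail (constS c) ⊛ a) n ≡ + 0
  zero-part = trans (sumTo-cong n (λ i _ → ℤP.*-zeroˡ (a (n ∸ i)))) (sumTo-zero n)

oneS≈constS : oneS ≈ constS (+ 1)
oneS≈constS = coeffwise λ { zero → refl ; (suc _) → refl }

⊛-identityˡ : ∀ a → oneS ⊛ a ≈ a
⊛-identityˡ a = coeffwise λ n → begin
  (oneS ⊛ a) n          ≡⟨ coeff (⊛-cong oneS≈constS (coeffwise {a} λ _ → refl)) n ⟩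
  (constS (+ 1) ⊛ a) n  ≡⟨ constS-⊛ (+ 1) a n ⟩
  + 1 ℤ.* a n           ≡⟨ ℤP.*-identityˡ (a n) ⟩
  a n                   ∎
  where open ≡-Reasoning

⊛-identityʳ : ∀ a → a ⊛ oneS ≈ a
⊛-identityʳ a = coeffwise λ n → trans (coeff (⊛-comm a oneS) n) (coeff (⊛-identityˡ a) n)

scale-⊛ : ∀ c a b → (c · a) ⊛ b ≈ c · (a ⊛ b)
scale-⊛ c a b = coeffwise λ n →
  trans (sumTo-cong n (λ i _ → ℤP.*-assoc c (a i) (b (n ∸ i)))) (sumTo-*ˡ n c _)

-- The recursion ⊛-suc peels off the constant term of the left factor, so associativity follows by
-- induction on the degree.
⊛-assoc-coeff : ∀ a b c n → ((a ⊛ b) ⊛ c) n ≡ (a ⊛ (b ⊛ c)) n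
⊛-assoc-coeff a b c zero    = ℤP.*-assoc (a 0) (b 0) (c 0)
⊛-assoc-coeff a b c (suc n) = begin
  ((a ⊛ b) ⊛ c) (suc n)
    ≡⟨ ⊛-suc (a ⊛ b) c n ⟩
  a 0 ℤ.* b 0 ℤ.* c (suc n) ℤ.+ (tail (a ⊛ b) ⊛ c) n
    ≡⟨ cong (ℤ._+_ (a 0 ℤ.* b 0 ℤ.* c (suc n))) tail-step ⟩
  a 0 ℤ.* b 0 ℤ.* c (suc n) ℤ.+ (a 0 ℤ.* (tail b ⊛ c) n ℤ.+ (tail a ⊛ (b ⊛ c)) n)
    ≡⟨ regroup (a 0) (b 0) (c (suc n)) _ _ ⟩
  a 0 ℤ.* (b 0 ℤ.* c (suc n) ℤ.+ (tail b ⊛ c) n) ℤ.+ (tail a ⊛ (b ⊛ c)) n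
    ≡⟨ cong (λ z → a 0 ℤ.* z ℤ.+ (tail a ⊛ (b ⊛ c)) n) (⊛-suc b c n) ⟨
  a 0 ℤ.* (b ⊛ c) (suc n) ℤ.+ (tail a ⊛ (b ⊛ c)) n
    ≡⟨ ⊛-suc a (b ⊛ c) n ⟨
  (a ⊛ (b ⊛ c)) (suc n) ∎
  where
  open ≡-Reasoning
  tail-step : (tail (a ⊛ b) ⊛ c) n ≡ a 0 ℤ.* (tail b ⊛ c) n ℤ.+ (tail a ⊛ (b ⊛ c)) n
  tail-step = begin
    (tail (a ⊛ b) ⊛ c) n
      ≡⟨ coeff (⊛-cong (coeffwise (⊛-suc a b)) (coeffwise {c} λ _ → refl)) n ⟩
    (((a 0 · tail b) ⊕ (tail a ⊛ b)) ⊛ c) n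
      ≡⟨ coeff (⊛-distribʳ c (a 0 · tail b) (tail a ⊛ b)) n ⟩
    ((a 0 · tail b) ⊛ c) n ℤ.+ ((tail a ⊛ b) ⊛ c) n
      ≡⟨ cong₂ ℤ._+_ (coeff (scale-⊛ (a 0) (tail b) c) n) (⊛-assoc-coeff (tail a) b c n) ⟩
    a 0 ℤ.* (tail b ⊛ c) n ℤ.+ (tail a ⊛ (b ⊛ c)) n ∎
  regroup : ∀ x y z u v → x ℤ.* y ℤ.* z ℤ.+ (x ℤ.* u ℤ.+ v) ≡ x ℤ.* (y ℤ.* z ℤ.+ u) ℤ.+ v
  regroup = ℤSolver.solve-∀

⊛-assoc : ∀ a b c → (a ⊛ b) ⊛ c ≈ a ⊛ (b ⊛ c)
⊛-assoc a b c = coeffwise (⊛-assoc-coeff a b c)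

seriesRing : CommutativeRing 0ℓ 0ℓ
seriesRing = record
  { Carrier = Series
  ; _≈_ = _≈_
  ; _+_ = _⊕_
  ; _*_ = _⊛_
  ; -_ = ⊝_
  ; 0# = zeroS
  ; 1# = oneS
  ; isCommutativeRing = record
    { isRing = record
      { +-isAbelianGroup = record
        { isGroup = record
          { isMonoid = record
            { isSemigroup = record
              { isMagma = record
                { isEquivalence = record
                  { refl = coeffwise λ _ → refl
                  ; sym = λ a≈b → coeffwise λ n → sym (coeff a≈b n)
                  ; trans = λ a≈b b≈c → coeffwise λ n → trans (coeff a≈b n) (coeff b≈c n)
                  }
                ; ∙-cong = λ a≈a′ b≈b′ → coeffwise λ n → cong₂ ℤ._+_ (coeff a≈a′ n) (coeff b≈b′ n)
                }
              ; assoc = λ a b c → coeffwise λ n → ℤP.+-assoc (a n) (b n) (c n)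
              }
            ; identity = (λ a → coeffwise λ n → ℤP.+-identityˡ (a n))
                       , (λ a → coeffwise λ n → ℤP.+-identityʳ (a n))
            }
          ; inverse = (λ a → coeffwise λ n → ℤP.+-inverseˡ (a n))
                    , (λ a → coeffwise λ n → ℤP.+-inverseʳ (a n))
          ; ⁻¹-cong = λ a≈b → coeffwise λ n → cong ℤ.-_ (coeff a≈b n)
          }
        ; comm = λ a b → coeffwise λ n → ℤP.+-comm (a n) (b n)
        }
      ; *-cong = ⊛-cong
      ; *-assoc = ⊛-assoc
      ; *-identity = ⊛-identityˡ , ⊛-identityʳ
      ; distrib = ⊛-distribˡ , ⊛-distribʳ
      }
    ; *-comm = ⊛-comm
    }
  }

open CommutativeRing seriesRing public
  using ()
  renaming ( refl to ≈-refl; sym to ≈-sym; trans to ≈-trans; reflexive to ≈-reflexive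
           ; +-cong to ⊕-cong; -‿cong to ⊝-cong; +-identityˡ to ⊕-identityˡ; +-identityʳ to ⊕-identityʳ)
open import Algebra.Properties.CommutativeSemiring.Exp (CommutativeRing.commutativeSemiring seriesRing) public
  renaming (_^_ to infixr 8 _^_)
  using (^-congˡ; ^-homo-*; ^-assocʳ; ^-distrib-*)
open import Algebra.Properties.CommutativeSemigroup (CommutativeRing.*-commutativeSemigroup seriesRing)
  using (interchange; x∙yz≈yx∙z; xy∙z≈xz∙y)
open import Algebra.Properties.CommutativeSemigroup (CommutativeRing.+-commutativeSemigroup seriesRing)
  using () renaming (interchange to ⊕-interchange)

module ≈-Reasoning = Relation.Binary.Reasoning.Setoid (CommutativeRing.setoid seriesRing)

constS-⊛-constS : ∀ a b → constS a ⊛ constS b ≈ constS (a ℤ.* b)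
constS-⊛-constS a b = coeffwise λ where
  zero    → refl
  (suc n) → trans (constS-⊛ a (constS b) (suc n)) (ℤP.*-zeroʳ a)

-- The coefficient embedding for the ring solver sends 0 and 1 to zeroS and oneS on the nose, so that
-- solved identities may mention them.
ℤ→Series : ℤ → Series
ℤ→Series (+ 0) = zeroS
ℤ→Series (+ 1) = oneS
ℤ→Series c     = constS c

ℤ→Series≈constS : ∀ c → ℤ→Series c ≈ constS c
ℤ→Series≈constS (+ 0)          = coeffwise λ { zero → refl ; (suc _) → refl }
ℤ→Series≈constS (+ 1)          = oneS≈constS
ℤ→Series≈constS +[1+ suc _ ]   = ≈-refl
ℤ→Series≈constS -[1+ _ ]       = ≈-refl

ℤ→Series-morphism : ℤ.+-*-rawRing -Raw-AlmostCommutative⟶ fromCommutativeRing seriesRing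
ℤ→Series-morphism = record
  { ⟦_⟧    = ℤ→Series
  ; +-homo = λ a b → begin
      ℤ→Series (a ℤ.+ b)              ≈⟨ ℤ→Series≈constS (a ℤ.+ b) ⟩
      constS (a ℤ.+ b)                ≈⟨ coeffwise (λ { zero → refl ; (suc _) → refl }) ⟩
      constS a ⊕ constS b             ≈⟨ ⊕-cong (ℤ→Series≈constS a) (ℤ→Series≈constS b) ⟨
      ℤ→Series a ⊕ ℤ→Series b         ∎
  ; *-homo = λ a b → begin
      ℤ→Series (a ℤ.* b)              ≈⟨ ℤ→Series≈constS (a ℤ.* b) ⟩
      constS (a ℤ.* b)                ≈⟨ constS-⊛-constS a b ⟨
      constS a ⊛ constS b             ≈⟨ ⊛-cong (ℤ→Series≈constS a) (ℤ→Series≈constS b) ⟨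
      ℤ→Series a ⊛ ℤ→Series b         ∎
  ; -‿homo = λ a → begin
      ℤ→Series (ℤ.- a)                ≈⟨ ℤ→Series≈constS (ℤ.- a) ⟩
      constS (ℤ.- a)                  ≈⟨ coeffwise (λ { zero → refl ; (suc _) → refl }) ⟩
      ⊝ constS a                      ≈⟨ ⊝-cong (ℤ→Series≈constS a) ⟨
      ⊝ ℤ→Series a                    ∎
  ; 0-homo = ≈-refl
  ; 1-homo = ≈-refl
  }
  where open ≈-Reasoning

ℤ→Series-≟ : ∀ a b → Maybe (ℤ→Series a ≈ ℤ→Series b)
ℤ→Series-≟ a b with a ℤP.≟ b
... | yes refl = just ≈-refl
... | no _     = nothing

module SeriesSolver = Algebra.Solver.Ring ℤ.+-*-rawRing (fromCommutativeRing seriesRing)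
  ℤ→Series-morphism ℤ→Series-≟

open SeriesSolver using (solve; _:=_; _:+_; _:-_; _:*_; _:^_; :-_; con)

powS≡^ : ∀ x n → powS x n ≡ x ^ n
powS≡^ x zero    = refl
powS≡^ x (suc n) = cong (x ⊛_) (powS≡^ x n)

shift : ℕ → Series → Series
shift zero    a n       = a n
shift (suc d) a zero    = + 0
shift (suc d) a (suc n) = shift d a n

infix 9 q^_

q^_ : ℕ → Series
q^ d = shift d oneS

shift-cong : ∀ d {a b} → a ≈ b → shift d a ≈ shift d b
shift-cong d a≈b = coeffwise (go d)
  where
  go : ∀ d n → shift d _ n ≡ shift d _ n
  go zero    n       = coeff a≈b n
  go (suc d) zero    = refl
  go (suc d) (suc n) = go d n

shift-below : ∀ d a {n} → n < d → shift d a n ≡ + 0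
shift-below (suc d) a {zero}  _         = refl
shift-below (suc d) a {suc n} (s≤s n<d) = shift-below d a n<d

shift-+ : ∀ d a n → shift d a (d + n) ≡ a n
shift-+ zero    a n = refl
shift-+ (suc d) a n = shift-+ d a n

shift-⊛-coeff : ∀ d a b n → (shift d a ⊛ b) n ≡ shift d (a ⊛ b) n
shift-⊛-coeff zero    a b n       = refl
shift-⊛-coeff (suc d) a b zero    = ℤP.*-zeroˡ (b 0)
shift-⊛-coeff (suc d) a b (suc n) = begin
  (shift (suc d) a ⊛ b) (suc n)            ≡⟨ ⊛-suc (shift (suc d) a) b n ⟩
  + 0 ℤ.* b (suc n) ℤ.+ (shift d a ⊛ b) n  ≡⟨ ℤP.+-identityˡ _ ⟩
  (shift d a ⊛ b) n                        ≡⟨ shift-⊛-coeff d a b n ⟩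
  shift d (a ⊛ b) n                        ∎
  where open ≡-Reasoning

q^-⊛ : ∀ d a → q^ d ⊛ a ≈ shift d a
q^-⊛ d a = ≈-trans (coeffwise (shift-⊛-coeff d oneS a)) (shift-cong d (⊛-identityˡ a))

q^-⊛-coeff-+ : ∀ E H N → (q^ E ⊛ H) (E + N) ≡ H N
q^-⊛-coeff-+ E H N = trans (coeff (q^-⊛ E H) (E + N)) (shift-+ E H N)

shift-shift : ∀ m n a k → shift m (shift n a) k ≡ shift (m + n) a k
shift-shift zero    n a k       = refl
shift-shift (suc m) n a zero    = refl
shift-shift (suc m) n a (suc k) = shift-shift m n a k

q^-+ : ∀ m n → q^ (m + n) ≈ q^ m ⊛ q^ n
q^-+ m n = ≈-sym (≈-trans (q^-⊛ m (q^ n)) (coeffwise (shift-shift m n oneS)))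

q^-+-⊛-coeff : ∀ E t H N → (q^ (E + t) ⊛ H) (E + N) ≡ (q^ t ⊛ H) N
q^-+-⊛-coeff E t H N =
  trans (coeff (≈-trans (⊛-congʳ H (q^-+ E t)) (⊛-assoc (q^ E) (q^ t) H)) (E + N)) (q^-⊛-coeff-+ E (q^ t ⊛ H) N)

q^-^ : ∀ d k → (q^ d) ^ k ≈ q^ (d * k)
q^-^ d zero    = ≈-reflexive (cong q^_ (sym (ℕP.*-zeroʳ d)))
q^-^ d (suc k) = begin
  q^ d ⊛ (q^ d) ^ k   ≈⟨ ⊛-congˡ (q^ d) (q^-^ d k) ⟩
  q^ d ⊛ q^ (d * k)   ≈⟨ q^-+ d (d * k) ⟨
  q^ (d + d * k)      ≡⟨ cong q^_ (ℕP.*-suc d k) ⟨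
  q^ (d * suc k)      ∎
  where open ≈-Reasoning

q^-coeff-≡ : ∀ d → (q^ d) d ≡ + 1
q^-coeff-≡ zero    = refl
q^-coeff-≡ (suc d) = q^-coeff-≡ d

q^-coeff-≢ : ∀ d {n} → n ≢ d → (q^ d) n ≡ + 0
q^-coeff-≢ zero    {zero}  n≢d = contradiction refl n≢d
q^-coeff-≢ zero    {suc n} _   = refl
q^-coeff-≢ (suc d) {zero}  _   = refl
q^-coeff-≢ (suc d) {suc n} n≢d = q^-coeff-≢ d (n≢d ∘ cong suc)

q^[m+k]-q^m : ∀ m k → q^ (m + k) ⊕ -1ₛ ⊛ q^ m ≈ -1ₛ ⊛ q^ m ⊛ (oneS ⊖ q^ k)
q^[m+k]-q^m m k = ≈-trans (⊕-cong (q^-+ m k) (≈-refl { -1ₛ ⊛ q^ m}))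
  (solve 2 (λ u v → u :* v :+ (:- con (+ 1)) :* u := (:- con (+ 1)) :* u :* (con (+ 1) :- v)) ≈-refl (q^ m) (q^ k))

q^m-q^[m+k] : ∀ m k → q^ m ⊕ -1ₛ ⊛ q^ (m + k) ≈ q^ m ⊛ (oneS ⊖ q^ k)
q^m-q^[m+k] m k = ≈-trans (⊕-cong (≈-refl {q^ m}) (⊛-congˡ -1ₛ (q^-+ m k)))
  (solve 2 (λ u v → u :+ (:- con (+ 1)) :* (u :* v) := u :* (con (+ 1) :- v)) ≈-refl (q^ m) (q^ k))

-- Agreement up to a power of q

infix 4 _≈_mod-q^_

record _≈_mod-q^_ (a b : Series) (M : ℕ) : Set where
  constructor coeffwise<
  field coeff< : ∀ n → n < M → a n ≡ b n

open _≈_mod-q^_ public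

≈⇒≈mod : ∀ {a b} M → a ≈ b → a ≈ b mod-q^ M
≈⇒≈mod M a≈b = coeffwise< λ n _ → coeff a≈b n

≈mod-all⇒≈ : ∀ {a b} → (∀ n → a ≈ b mod-q^ suc n) → a ≈ b
≈mod-all⇒≈ a≈b = coeffwise λ n → coeff< (a≈b n) n ℕP.≤-refl

≈mod-refl : ∀ {a M} → a ≈ a mod-q^ M
≈mod-refl = coeffwise< λ _ _ → refl

≈mod-isEquivalence : ∀ M → IsEquivalence (λ a b → a ≈ b mod-q^ M)
≈mod-isEquivalence M = record
  { refl  = ≈mod-refl
  ; sym   = λ a≈b → coeffwise< λ n n<M → sym (coeff< a≈b n n<M)
  ; trans = λ a≈b b≈c → coeffwise< λ n n<M → trans (coeff< a≈b n n<M) (coeff< b≈c n n<M)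
  }

≈mod-setoid : ℕ → Setoid 0ℓ 0ℓ
≈mod-setoid M = record { isEquivalence = ≈mod-isEquivalence M }

module ≈mod-Reasoning (M : ℕ) = Relation.Binary.Reasoning.Setoid (≈mod-setoid M)

≈mod-mono : ∀ {a b M N} → N ≤ M → a ≈ b mod-q^ M → a ≈ b mod-q^ N
≈mod-mono N≤M a≈b = coeffwise< λ n n<N → coeff< a≈b n (ℕP.<-≤-trans n<N N≤M)

⊛-cong-mod : ∀ {a a′ b b′ M} → a ≈ a′ mod-q^ M → b ≈ b′ mod-q^ M → a ⊛ b ≈ a′ ⊛ b′ mod-q^ M
⊛-cong-mod a≈a′ b≈b′ = coeffwise< λ n n<M → sumTo-cong n λ i i≤n →
  cong₂ ℤ._*_ (coeff< a≈a′ i (ℕP.≤-<-trans i≤n n<M))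
              (coeff< b≈b′ _ (ℕP.≤-<-trans (ℕP.m∸n≤m n i) n<M))

q^-⊛-coeff≡0 : ∀ t H N → t ≢ N → H ≈ oneS mod-q^ (suc N ∸ t) → (q^ t ⊛ H) N ≡ + 0
q^-⊛-coeff≡0 t H N t≢N H≈1 with t ℕP.≤? N
... | no  t≰N = trans (coeff (q^-⊛ t H) N) (shift-below t H (ℕP.≰⇒> t≰N))
... | yes t≤N with ℕP.m≤n⇒∃[o]m+o≡n t≤N
...   | zero  , t+0≡N = contradiction (trans (sym (ℕP.+-identityʳ t)) t+0≡N) t≢N
...   | suc j , refl  = begin
  (q^ t ⊛ H) (t + suc j)   ≡⟨ coeff (q^-⊛ t H) (t + suc j) ⟩
  shift t H (t + suc j)    ≡⟨ shift-+ t H (suc j) ⟩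
  H (suc j)                ≡⟨ coeff< H≈1 (suc j) j<1+N∸t ⟩
  + 0                      ∎
  where
  open ≡-Reasoning
  j<1+N∸t : suc j < suc (t + suc j) ∸ t
  j<1+N∸t = ℕP.≤-reflexive (sym (trans (cong (_∸ t) (sym (ℕP.+-suc t (suc j)))) (ℕP.m+n∸m≡n t (suc (suc j)))))

-- Finite products and the series f m

infix 9 ∏

∏ : ℕ → (ℕ → Series) → Series
∏ zero    F = oneS
∏ (suc n) F = ∏ n F ⊛ F n

syntax ∏ n (λ i → F) = ∏[ i < n ] F

∏-cong : ∀ n {F G} → (∀ i → i < n → F i ≈ G i) → ∏ n F ≈ ∏ n G
∏-cong zero    F≈G = ≈-refl
∏-cong (suc n) F≈G = ⊛-cong (∏-cong n (λ i i<n → F≈G i (ℕP.m<n⇒m<1+n i<n))) (F≈G n ℕP.≤-refl)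

∏-≈oneS : ∀ n {F} → (∀ i → i < n → F i ≈ oneS) → ∏ n F ≈ oneS
∏-≈oneS zero    F≈1 = ≈-refl
∏-≈oneS (suc n) F≈1 =
  ≈-trans (⊛-cong (∏-≈oneS n (λ i i<n → F≈1 i (ℕP.m<n⇒m<1+n i<n))) (F≈1 n ℕP.≤-refl)) (⊛-identityˡ oneS)

∏-⊛ : ∀ n F G → ∏[ i < n ] (F i ⊛ G i) ≈ ∏ n F ⊛ ∏ n G
∏-⊛ zero    F G = ≈-sym (⊛-identityˡ oneS)
∏-⊛ (suc n) F G = ≈-trans (⊛-congʳ (F n ⊛ G n) (∏-⊛ n F G)) (interchange (∏ n F) (∏ n G) (F n) (G n))

∏-+ : ∀ m n F → ∏ (m + n) F ≈ ∏ m F ⊛ ∏[ i < n ] F (m + i)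
∏-+ m zero    F = ≈-trans (≈-reflexive (cong (λ k → ∏ k F) (ℕP.+-identityʳ m))) (≈-sym (⊛-identityʳ (∏ m F)))
∏-+ m (suc n) F = begin
  ∏ (m + suc n) F                                       ≡⟨ cong (λ k → ∏ k F) (ℕP.+-suc m n) ⟩
  ∏ (m + n) F ⊛ F (m + n)                               ≈⟨ ⊛-congʳ (F (m + n)) (∏-+ m n F) ⟩
  ∏ m F ⊛ ∏[ i < n ] F (m + i) ⊛ F (m + n)              ≈⟨ ⊛-assoc (∏ m F) (∏[ i < n ] F (m + i)) (F (m + n)) ⟩
  ∏ m F ⊛ ∏[ i < suc n ] F (m + i)                      ∎
  where open ≈-Reasoning

∏-interleave : ∀ n F → ∏ (n + n) F ≈ ∏[ i < n ] F (i + i) ⊛ ∏[ i < n ] F (suc (i + i))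
∏-interleave zero    F = ≈-sym (⊛-identityˡ oneS)
∏-interleave (suc n) F = begin
  ∏ (suc n + suc n) F                                   ≡⟨ cong (λ k → ∏ (suc k) F) (ℕP.+-suc n n) ⟩
  ∏ (n + n) F ⊛ F (n + n) ⊛ F (suc (n + n))             ≈⟨ ⊛-congʳ (F (suc (n + n))) (⊛-congʳ (F (n + n)) (∏-interleave n F)) ⟩
  Evens ⊛ Odds ⊛ F (n + n) ⊛ F (suc (n + n))            ≈⟨ ⊛-assoc (Evens ⊛ Odds) (F (n + n)) (F (suc (n + n))) ⟩
  Evens ⊛ Odds ⊛ (F (n + n) ⊛ F (suc (n + n)))          ≈⟨ interchange Evens Odds (F (n + n)) (F (suc (n + n))) ⟩
  Evens ⊛ F (n + n) ⊛ (Odds ⊛ F (suc (n + n)))          ∎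
  where
  open ≈-Reasoning
  Evens = ∏[ i < n ] F (i + i)
  Odds  = ∏[ i < n ] F (suc (i + i))

∏-unfoldˡ : ∀ n F → ∏ (suc n) F ≈ F 0 ⊛ ∏[ i < n ] F (suc i)
∏-unfoldˡ zero    F = ≈-trans (⊛-identityˡ (F 0)) (≈-sym (⊛-identityʳ (F 0)))
∏-unfoldˡ (suc n) F =
  ≈-trans (⊛-congʳ (F (suc n)) (∏-unfoldˡ n F)) (⊛-assoc (F 0) (∏[ i < n ] F (suc i)) (F (suc n)))

∏-reverse : ∀ n F → ∏[ i < n ] F (n ∸ suc i) ≈ ∏ n F
∏-reverse zero    F = ≈-refl
∏-reverse (suc n) F = begin
  ∏[ i < suc n ] F (n ∸ i)                 ≈⟨ ∏-unfoldˡ n (λ i → F (n ∸ i)) ⟩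
  F n ⊛ ∏[ i < n ] F (n ∸ suc i)           ≈⟨ ⊛-congˡ (F n) (∏-reverse n F) ⟩
  F n ⊛ ∏ n F                              ≈⟨ ⊛-comm (F n) (∏ n F) ⟩
  ∏ (suc n) F                              ∎
  where open ≈-Reasoning

∏-const : ∀ n x → ∏[ i < n ] x ≈ x ^ n
∏-const zero    x = ≈-refl
∏-const (suc n) x = ≈-trans (⊛-congʳ x (∏-const n x)) (⊛-comm (x ^ n) x)

prodTo≈∏ : ∀ n F → prodTo n F ≈ ∏[ i < n ] F (suc i)
prodTo≈∏ zero    F = ≈-refl
prodTo≈∏ (suc n) F = ⊛-congʳ (F (suc n)) (prodTo≈∏ n F)

prodTo-stable : ∀ (F : ℕ → Series) → (∀ k → F k ≈ oneS mod-q^ k) →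
                ∀ {i K} → i ≤ K → prodTo K F ≈ prodTo i F mod-q^ suc i
prodTo-stable F F≈1 {K = zero}  z≤n = ≈mod-refl
prodTo-stable F F≈1 {i} {suc K} i≤1+K with ℕP.m≤n⇒m<n∨m≡n i≤1+K
... | inj₂ refl = ≈mod-refl
... | inj₁ (s≤s i≤K) = begin
  prodTo K F ⊛ F (suc K)  ≈⟨ ⊛-cong-mod (≈mod-refl {prodTo K F}) (≈mod-mono (s≤s i≤K) (F≈1 (suc K))) ⟩
  prodTo K F ⊛ oneS       ≈⟨ ≈⇒≈mod (suc i) (⊛-identityʳ (prodTo K F)) ⟩
  prodTo K F              ≈⟨ prodTo-stable F F≈1 i≤K ⟩
  prodTo i F              ∎
  where open ≈mod-Reasoning (suc i)

-- Defs encodes f m and fInv m as such diagonals n ↦ (∏_{k≤n} F k)ₙ.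
prodTo-diagonal : ∀ (F : ℕ → Series) → (∀ k → F k ≈ oneS mod-q^ k) →
                  ∀ K → (λ n → prodTo n F n) ≈ prodTo K F mod-q^ suc K
prodTo-diagonal F F≈1 K = coeffwise< λ n n<1+K →
  sym (coeff< (prodTo-stable F F≈1 (ℕP.≤-pred n<1+K)) n ℕP.≤-refl)

oneMinus≈1 : ∀ d → oneMinus d ≈ oneS mod-q^ d
oneMinus≈1 d = coeffwise< go
  where
  go : ∀ n → n < d → oneMinus d n ≡ oneS n
  go zero    _   = refl
  go (suc n) n<d with suc n ℕP.≟ d
  ... | yes refl = contradiction n<d (ℕP.<-irrefl refl)
  ... | no _     = refl

oneMinus≈1-q^ : ∀ d .{{_ : NonZero d}} → oneMinus d ≈ oneS ⊖ q^ d
oneMinus≈1-q^ d@(suc _) = coeffwise go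
  where
  go : ∀ n → oneMinus d n ≡ (oneS ⊖ q^ d) n
  go zero    = refl
  go (suc n) with suc n ℕP.≟ d
  ... | yes refl = cong (λ c → + 0 ℤ.+ ℤ.- c) (sym (q^-coeff-≡ d))
  ... | no 1+n≢d = cong (λ c → + 0 ℤ.+ ℤ.- c) (sym (q^-coeff-≢ d 1+n≢d))

geomInv≈1 : ∀ d → geomInv d ≈ oneS mod-q^ d
geomInv≈1 d = coeffwise< go
  where
  go : ∀ n → n < d → geomInv d n ≡ oneS n
  go zero    _   with d ℕ∣.∣? 0
  ... | yes _  = refl
  ... | no d∤0 = contradiction (d ℕ∣.∣0) d∤0
  go (suc n) n<d with d ℕ∣.∣? suc n
  ... | yes d∣1+n = contradiction (ℕ∣.∣⇒≤ d∣1+n) (ℕP.<⇒≱ n<d)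
  ... | no _      = refl

geomInv-+ : ∀ d r → geomInv d (d + r) ≡ geomInv d r
geomInv-+ d r with d ℕ∣.∣? (d + r) | d ℕ∣.∣? r
... | yes _      | yes _    = refl
... | no  _      | no  _    = refl
... | yes d∣d+r  | no d∤r   = contradiction (ℕ∣.∣m+n∣m⇒∣n d∣d+r ℕ∣.∣-refl) d∤r
... | no  d∤d+r  | yes d∣r  = contradiction (ℕ∣.∣m∣n⇒∣m+n ℕ∣.∣-refl d∣r) d∤d+r

geomInv-unfold : ∀ d .{{_ : NonZero d}} → geomInv d ≈ oneS ⊕ q^ d ⊛ geomInv d
geomInv-unfold d@(suc _) = ≈-trans (coeffwise go) (⊕-cong (≈-refl {oneS}) (≈-sym (q^-⊛ d (geomInv d))))
  where
  go : ∀ n → geomInv d n ≡ (oneS ⊕ shift d (geomInv d)) n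
  go n with n ℕP.<? d
  ... | yes n<d = begin
    geomInv d n                        ≡⟨ coeff< (geomInv≈1 d) n n<d ⟩
    oneS n                             ≡⟨ ℤP.+-identityʳ (oneS n) ⟨
    oneS n ℤ.+ + 0                     ≡⟨ cong (ℤ._+_ (oneS n)) (shift-below d (geomInv d) n<d) ⟨
    oneS n ℤ.+ shift d (geomInv d) n   ∎
    where open ≡-Reasoning
  ... | no n≮d = subst (λ m → geomInv d m ≡ (oneS ⊕ shift d (geomInv d)) m)
                       (ℕP.m+[n∸m]≡n (ℕP.≮⇒≥ n≮d)) (above (n ∸ d))
    where
    above : ∀ r → geomInv d (d + r) ≡ (oneS ⊕ shift d (geomInv d)) (d + r)
    above r = begin
      geomInv d (d + r)                                  ≡⟨ geomInv-+ d r ⟩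
      geomInv d r                                        ≡⟨ shift-+ d (geomInv d) r ⟨
      shift d (geomInv d) (d + r)                        ≡⟨ ℤP.+-identityˡ _ ⟨
      oneS (d + r) ℤ.+ shift d (geomInv d) (d + r)       ∎
      where open ≡-Reasoning

[1-q^d]⊛geomInv : ∀ d .{{_ : NonZero d}} → (oneS ⊖ q^ d) ⊛ geomInv d ≈ oneS
[1-q^d]⊛geomInv d = begin
  (oneS ⊖ q^ d) ⊛ geomInv d
    ≈⟨ solve 2 (λ x g → (con (+ 1) :- x) :* g := g :- x :* g) ≈-refl (q^ d) (geomInv d) ⟩
  geomInv d ⊖ q^ d ⊛ geomInv d
    ≈⟨ ⊕-cong (geomInv-unfold d) (≈-refl {⊝ (q^ d ⊛ geomInv d)}) ⟩
  (oneS ⊕ q^ d ⊛ geomInv d) ⊖ q^ d ⊛ geomInv d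
    ≈⟨ solve 2 (λ u v → (u :+ v) :- v := u) ≈-refl oneS (q^ d ⊛ geomInv d) ⟩
  oneS ∎
  where open ≈-Reasoning

f≈∏ : ∀ m .{{_ : NonZero m}} K → f m ≈ ∏[ i < K ] (oneS ⊖ q^ (m * suc i)) mod-q^ suc K
f≈∏ m K = begin
  f m
    ≈⟨ prodTo-diagonal _ factor≈1 K ⟩
  prodTo K (λ k → oneMinus (m * k))
    ≈⟨ ≈⇒≈mod (suc K) (prodTo≈∏ K _) ⟩
  ∏[ i < K ] oneMinus (m * suc i)
    ≈⟨ ≈⇒≈mod (suc K) (∏-cong K (λ i _ → oneMinus≈1-q^ (m * suc i) {{ℕP.m*n≢0 m (suc i)}})) ⟩
  ∏[ i < K ] (oneS ⊖ q^ (m * suc i)) ∎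
  where
  open ≈mod-Reasoning (suc K)
  factor≈1 : ∀ k → oneMinus (m * k) ≈ oneS mod-q^ k
  factor≈1 k = ≈mod-mono (ℕP.m≤n*m k m) (oneMinus≈1 (m * k))

fInv≈∏ : ∀ m .{{_ : NonZero m}} K → fInv m ≈ ∏[ i < K ] geomInv (m * suc i) mod-q^ suc K
fInv≈∏ m K = begin
  fInv m                                    ≈⟨ prodTo-diagonal _ factor≈1 K ⟩
  prodTo K (λ k → geomInv (m * k))          ≈⟨ ≈⇒≈mod (suc K) (prodTo≈∏ K _) ⟩
  ∏[ i < K ] geomInv (m * suc i)            ∎
  where
  open ≈mod-Reasoning (suc K)
  factor≈1 : ∀ k → geomInv (m * k) ≈ oneS mod-q^ k
  factor≈1 k = ≈mod-mono (ℕP.m≤n*m k m) (geomInv≈1 (m * k))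

f⊛fInv : ∀ m .{{_ : NonZero m}} → f m ⊛ fInv m ≈ oneS
f⊛fInv m = ≈mod-all⇒≈ truncated
  where
  truncated : ∀ K → f m ⊛ fInv m ≈ oneS mod-q^ suc K
  truncated K = begin
    f m ⊛ fInv m
      ≈⟨ ⊛-cong-mod (f≈∏ m K) (fInv≈∏ m K) ⟩
    ∏[ i < K ] (oneS ⊖ q^ (m * suc i)) ⊛ ∏[ i < K ] geomInv (m * suc i)
      ≈⟨ ≈⇒≈mod (suc K) (≈-sym (∏-⊛ K _ _)) ⟩
    ∏[ i < K ] ((oneS ⊖ q^ (m * suc i)) ⊛ geomInv (m * suc i))
      ≈⟨ ≈⇒≈mod (suc K) (∏-≈oneS K (λ i _ → [1-q^d]⊛geomInv (m * suc i) {{ℕP.m*n≢0 m (suc i)}})) ⟩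
    oneS ∎
    where open ≈mod-Reasoning (suc K)

fInv⊛f : ∀ m .{{_ : NonZero m}} → fInv m ⊛ f m ≈ oneS
fInv⊛f m = ≈-trans (⊛-comm (fInv m) (f m)) (f⊛fInv m)

⊛-f⊛fInv : ∀ m .{{_ : NonZero m}} x → x ⊛ f m ⊛ fInv m ≈ x
⊛-f⊛fInv m x = ≈-trans (⊛-assoc x (f m) (fInv m)) (≈-trans (⊛-congˡ x (f⊛fInv m)) (⊛-identityʳ x))

-- Series in q³ modulo 3

∣-sumTo : ∀ {k} n (g : ℕ → ℤ) → (∀ i → i ≤ n → k Signed.∣ g i) → k Signed.∣ sumTo n g
∣-sumTo zero    g k∣g = k∣g 0 z≤n
∣-sumTo (suc n) g k∣g =
  ∣m∣n⇒∣m+n (∣-sumTo n g (λ i i≤n → k∣g i (ℕP.m≤n⇒m≤1+n i≤n))) (k∣g (suc n) ℕP.≤-refl)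

-- The series is congruent modulo 3 to a power series in q³.
record InQ³Mod3 (a : Series) : Set where
  constructor inQ³Mod3
  field 3∣coeff : ∀ n → n % 3 ≢ 0 → + 3 Signed.∣ a n

open InQ³Mod3 public

record 3∣CoeffsAt (r : ℕ) (a : Series) : Set where
  constructor 3∣coeffsAt
  field 3∣coeffAt : ∀ n → n % 3 ≡ r → + 3 Signed.∣ a n

open 3∣CoeffsAt public

InQ³-resp : ∀ {a b} → a ≈ b → InQ³Mod3 a → InQ³Mod3 b
InQ³-resp a≈b a∈ = inQ³Mod3 λ n n≢0 → subst (+ 3 Signed.∣_) (coeff a≈b n) (3∣coeff a∈ n n≢0)

3∣CoeffsAt-resp : ∀ {r a b} → a ≈ b → 3∣CoeffsAt r a → 3∣CoeffsAt r b
3∣CoeffsAt-resp a≈b 3∣a = 3∣coeffsAt λ n n≡r → subst (+ 3 Signed.∣_) (coeff a≈b n) (3∣coeffAt 3∣a n n≡r)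

oneS-InQ³ : InQ³Mod3 oneS
oneS-InQ³ = inQ³Mod3 λ where
  zero    0≢0 → contradiction refl 0≢0
  (suc n) _   → divides (+ 0) refl

%3-∸ : ∀ {i n} → i ≤ n → i % 3 ≡ 0 → (n ∸ i) % 3 ≡ n % 3
%3-∸ {i} {n} i≤n i%3≡0 = trans (sym (%-remove-+ʳ (n ∸ i) (ℕ∣.m%n≡0⇒n∣m i 3 i%3≡0)))
                               (cong (_% 3) (ℕP.m∸n+n≡m i≤n))

⊛-3∣CoeffsAt : ∀ {h y r} → InQ³Mod3 h → 3∣CoeffsAt r y → 3∣CoeffsAt r (h ⊛ y)
⊛-3∣CoeffsAt {h} {y} h∈ 3∣y = 3∣coeffsAt λ n n≡r → ∣-sumTo n _ (term n n≡r)
  where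
  term : ∀ n → n % 3 ≡ _ → ∀ i → i ≤ n → + 3 Signed.∣ h i ℤ.* y (n ∸ i)
  term n n≡r i i≤n with i % 3 ℕP.≟ 0
  ... | yes i≡0 = ∣n⇒∣m*n (h i) (3∣coeffAt 3∣y (n ∸ i) (trans (%3-∸ i≤n i≡0) n≡r))
  ... | no  i≢0 = ∣m⇒∣m*n (y (n ∸ i)) (3∣coeff h∈ i i≢0)

⊛-InQ³ : ∀ {h y} → InQ³Mod3 h → InQ³Mod3 y → InQ³Mod3 (h ⊛ y)
⊛-InQ³ h∈ y∈ = inQ³Mod3 λ n n≢0 →
  3∣coeffAt (⊛-3∣CoeffsAt h∈ (3∣coeffsAt λ m m≡n → 3∣coeff y∈ m (n≢0 ∘ trans (sym m≡n)))) n refl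

^-InQ³ : ∀ {y} j → InQ³Mod3 y → InQ³Mod3 (y ^ j)
^-InQ³ zero    y∈ = oneS-InQ³
^-InQ³ (suc j) y∈ = ⊛-InQ³ y∈ (^-InQ³ j y∈)

cube-expansion : ∀ c s → (c ⊕ s) ^ 3 ≈ c ^ 3 ⊕ constS (+ 3) ⊛ (c ^ 2 ⊛ s ⊕ c ⊛ s ^ 2) ⊕ s ^ 3
cube-expansion = solve 2 (λ c s → (c :+ s) :^ 3 := c :^ 3 :+ con (+ 3) :* (c :^ 2 :* s :+ c :* s :^ 2) :+ s :^ 3) ≈-refl

split-constant-term : ∀ x → x ≈ constS (x 0) ⊕ q^ 1 ⊛ tail x
split-constant-term x = ≈-trans (coeffwise λ where
    zero    → sym (ℤP.+-identityʳ (x 0))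
    (suc n) → sym (ℤP.+-identityˡ (x (suc n))))
  (⊕-cong (≈-refl {constS (x 0)}) (≈-sym (q^-⊛ 1 (tail x))))

-- Frobenius: (c + q t)³ ≡ c³ + q³ t³ (mod 3) with c³ constant, so induct on the degree.
cube-InQ³ : ∀ x → InQ³Mod3 (x ^ 3)
cube-InQ³ x = inQ³Mod3 (go x)
  where
  go : ∀ x n → n % 3 ≢ 0 → + 3 Signed.∣ (x ^ 3) n
  go x n n≢0 = subst (+ 3 Signed.∣_) (sym (coeff x³≈ n))
    (∣m∣n⇒∣m+n (∣m∣n⇒∣m+n constant-part middle-part) cube-part)
    where
    c t mixed : Series
    c = constS (x 0)
    t = tail x
    mixed = c ^ 2 ⊛ (q^ 1 ⊛ t) ⊕ c ⊛ (q^ 1 ⊛ t) ^ 2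
    x³≈ : x ^ 3 ≈ c ^ 3 ⊕ constS (+ 3) ⊛ mixed ⊕ (q^ 1 ⊛ t) ^ 3
    x³≈ = ≈-trans (^-congˡ 3 (split-constant-term x)) (cube-expansion c (q^ 1 ⊛ t))
    constant-part : + 3 Signed.∣ (c ^ 3) n
    constant-part = subst (+ 3 Signed.∣_) (sym (coeff c³≈ n)) (divides (+ 0) (constant-coeff n n≢0))
      where
      c³≈ : c ^ 3 ≈ constS (x 0 ℤ.* (x 0 ℤ.* x 0))
      c³≈ = ≈-trans (⊛-congˡ c (≈-trans (⊛-congˡ c (⊛-identityʳ c)) (constS-⊛-constS (x 0) (x 0))))
                    (constS-⊛-constS (x 0) (x 0 ℤ.* x 0))
      constant-coeff : ∀ n → n % 3 ≢ 0 → constS (x 0 ℤ.* (x 0 ℤ.* x 0)) n ≡ + 0 ℤ.* + 3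
      constant-coeff zero    0≢0 = contradiction refl 0≢0
      constant-coeff (suc n) _   = refl
    middle-part : + 3 Signed.∣ (constS (+ 3) ⊛ mixed) n
    middle-part = subst (+ 3 Signed.∣_) (sym (constS-⊛ (+ 3) mixed n)) (∣m⇒∣m*n (mixed n) Signed.∣-refl)
    cube-part : + 3 Signed.∣ ((q^ 1 ⊛ t) ^ 3) n
    cube-part = subst (+ 3 Signed.∣_) (sym (coeff q[t]³≈ n)) (shifted n n≢0)
      where
      q[t]³≈ : (q^ 1 ⊛ t) ^ 3 ≈ shift 3 (t ^ 3)
      q[t]³≈ = ≈-trans (^-distrib-* (q^ 1) t 3) (≈-trans (⊛-congʳ (t ^ 3) (q^-^ 1 3)) (q^-⊛ 3 (t ^ 3)))
      shifted : ∀ n → n % 3 ≢ 0 → + 3 Signed.∣ shift 3 (t ^ 3) n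
      shifted 0 _ = divides (+ 0) refl
      shifted 1 _ = divides (+ 0) refl
      shifted 2 _ = divides (+ 0) refl
      shifted (suc (suc (suc m))) n≢0 =
        go t m (n≢0 ∘ trans (trans (cong (_% 3) (ℕP.+-comm 3 m)) ([m+n]%n≡m%n m 3)))

^3*-InQ³ : ∀ x j → InQ³Mod3 (x ^ (3 * j))
^3*-InQ³ x j = InQ³-resp (^-assocʳ x 3 j) (^-InQ³ j (cube-InQ³ x))

infix 4 _∼₃_

record _∼₃_ (a b : Series) : Set where
  constructor factor
  field
    cofactor      : Series
    cofactor-InQ³ : InQ³Mod3 cofactor
    factorisation : a ≈ cofactor ⊛ b

∼₃-⊛ : ∀ {a b c d} → a ∼₃ b → c ∼₃ d → a ⊛ c ∼₃ b ⊛ d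
∼₃-⊛ {b = b} {d = d} (factor h h∈ a≈hb) (factor k k∈ c≈kd) =
  factor (h ⊛ k) (⊛-InQ³ h∈ k∈) (≈-trans (⊛-cong a≈hb c≈kd) (interchange h b k d))

∼₃-trans : ∀ {a b c} → a ∼₃ b → b ∼₃ c → a ∼₃ c
∼₃-trans {c = c} (factor h h∈ a≈hb) (factor k k∈ b≈kc) =
  factor (h ⊛ k) (⊛-InQ³ h∈ k∈) (≈-trans a≈hb (≈-trans (⊛-congˡ h b≈kc) (≈-sym (⊛-assoc h k c))))

∼₃-respˡ : ∀ {a a′ b} → a′ ≈ a → a ∼₃ b → a′ ∼₃ b
∼₃-respˡ a′≈a (factor h h∈ a≈hb) = factor h h∈ (≈-trans a′≈a a≈hb)

∼₃-InQ³ : ∀ {a b} → InQ³Mod3 b → a ∼₃ b → InQ³Mod3 a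
∼₃-InQ³ b∈ (factor h h∈ a≈hb) = InQ³-resp (≈-sym a≈hb) (⊛-InQ³ h∈ b∈)

∼₃-3∣CoeffsAt : ∀ {a b r} → a ∼₃ b → 3∣CoeffsAt r b → 3∣CoeffsAt r a
∼₃-3∣CoeffsAt (factor h h∈ a≈hb) 3∣b = 3∣CoeffsAt-resp (≈-sym a≈hb) (⊛-3∣CoeffsAt h∈ 3∣b)

fPow-suc : ∀ m .{{_ : NonZero m}} e → fPow m (e ℤ.+ + 1) ≈ fPow m e ⊛ f m
fPow-suc m (+ n) = begin
  powS (f m) (n + 1)          ≡⟨ powS≡^ (f m) (n + 1) ⟩
  f m ^ (n + 1)               ≈⟨ ^-homo-* (f m) n 1 ⟩
  f m ^ n ⊛ (f m ⊛ oneS)      ≈⟨ ⊛-cong (≈-reflexive (sym (powS≡^ (f m) n))) (⊛-identityʳ (f m)) ⟩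
  powS (f m) n ⊛ f m          ∎
  where open ≈-Reasoning
fPow-suc m -[1+ 0 ] = begin
  oneS                        ≈⟨ fInv⊛f m ⟨
  fInv m ⊛ f m                ≈⟨ ⊛-congʳ (f m) (⊛-identityʳ (fInv m)) ⟨
  (fInv m ⊛ oneS) ⊛ f m       ∎
  where open ≈-Reasoning
fPow-suc m -[1+ suc n ] = begin
  powS (fInv m) (suc n)                        ≈⟨ ⊛-identityʳ _ ⟨
  powS (fInv m) (suc n) ⊛ oneS                 ≈⟨ ⊛-congˡ (powS (fInv m) (suc n)) (fInv⊛f m) ⟨
  powS (fInv m) (suc n) ⊛ (fInv m ⊛ f m)       ≈⟨ x∙yz≈yx∙z (powS (fInv m) (suc n)) (fInv m) (f m) ⟩
  (fInv m ⊛ powS (fInv m) (suc n)) ⊛ f m       ∎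
  where open ≈-Reasoning

fPow-+ : ∀ m .{{_ : NonZero m}} e k → fPow m (e ℤ.+ + k) ≈ fPow m e ⊛ f m ^ k
fPow-+ m e zero    = ≈-trans (≈-reflexive (cong (fPow m) (ℤP.+-identityʳ e))) (≈-sym (⊛-identityʳ (fPow m e)))
fPow-+ m e (suc k) = begin
  fPow m (e ℤ.+ + suc k)            ≡⟨ cong (fPow m) (ℤP.+-assoc e (+ 1) (+ k)) ⟨
  fPow m (e ℤ.+ + 1 ℤ.+ + k)        ≈⟨ fPow-+ m (e ℤ.+ + 1) k ⟩
  fPow m (e ℤ.+ + 1) ⊛ f m ^ k      ≈⟨ ⊛-congʳ (f m ^ k) (fPow-suc m e) ⟩
  (fPow m e ⊛ f m) ⊛ f m ^ k        ≈⟨ ⊛-assoc (fPow m e) (f m) (f m ^ k) ⟩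
  fPow m e ⊛ f m ^ suc k            ∎
  where open ≈-Reasoning

fPow-InQ³ : ∀ m e j → ℤ.∣ e ∣ ≡ 3 * j → InQ³Mod3 (fPow m e)
fPow-InQ³ m (+ n)    j n≡3j   =
  InQ³-resp (≈-reflexive (sym (trans (powS≡^ (f m) n) (cong (f m ^_) n≡3j)))) (^3*-InQ³ (f m) j)
fPow-InQ³ m -[1+ n ] j 1+n≡3j =
  InQ³-resp (≈-reflexive (sym (trans (powS≡^ (fInv m) (suc n)) (cong (fInv m ^_) 1+n≡3j)))) (^3*-InQ³ (fInv m) j)

fPow-∼₃ : ∀ m .{{_ : NonZero m}} t ρ → fPow m (+ 3 ℤ.* t ℤ.+ + ρ) ∼₃ f m ^ ρ
fPow-∼₃ m t ρ = factor (fPow m (+ 3 ℤ.* t)) (fPow-InQ³ m (+ 3 ℤ.* t) ℤ.∣ t ∣ (ℤP.abs-* (+ 3) t))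
                       (fPow-+ m (+ 3 ℤ.* t) ρ)

abar-∼₃ : ∀ r s t₁ t₂ t₃ ρ₁ ρ₂ ρ₃ →
          + 3 ℤ.* + s ℤ.- + 2 ℤ.* + r ≡ + 3 ℤ.* t₁ ℤ.+ + ρ₁ →
          ℤ.- (+ 2 ℤ.* + s)           ≡ + 3 ℤ.* t₂ ℤ.+ + ρ₂ →
          + r ℤ.- + s                 ≡ + 3 ℤ.* t₃ ℤ.+ + ρ₃ →
          abar r s ∼₃ (f 2 ^ ρ₁ ⊛ f 1 ^ ρ₂) ⊛ f 4 ^ ρ₃
abar-∼₃ r s t₁ t₂ t₃ ρ₁ ρ₂ ρ₃ e₁ e₂ e₃ =
  ∼₃-respˡ (⊛-cong (⊛-cong (≈-reflexive (cong (fPow 2) e₁)) (≈-reflexive (cong (fPow 1) e₂)))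
                    (≈-reflexive (cong (fPow 4) e₃)))
    (∼₃-⊛ (∼₃-⊛ (fPow-∼₃ 2 t₁ ρ₁) (fPow-∼₃ 1 t₂ ρ₂)) (fPow-∼₃ 4 t₃ ρ₃))

-- The Cauchy binomial theorem

infix 9 antidiagonalSum

antidiagonalSum : ℕ → (ℕ → ℕ → Series) → Series
antidiagonalSum zero    h = h 0 0
antidiagonalSum (suc N) h = h 0 (suc N) ⊕ antidiagonalSum N (λ a b → h (suc a) b)

syntax antidiagonalSum N (λ a b → h) = ∑[ a + b ≡ N ] h

∑-cong : ∀ N {h g} → (∀ a b → a + b ≡ N → h a b ≈ g a b) → antidiagonalSum N h ≈ antidiagonalSum N g
∑-cong zero    h≈g = h≈g 0 0 refl
∑-cong (suc N) h≈g = ⊕-cong (h≈g 0 (suc N) refl) (∑-cong N (λ a b a+b≡N → h≈g (suc a) b (cong suc a+b≡N)))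

∑-⊕ : ∀ N h g → ∑[ a + b ≡ N ] (h a b ⊕ g a b) ≈ antidiagonalSum N h ⊕ antidiagonalSum N g
∑-⊕ zero    h g = ≈-refl
∑-⊕ (suc N) h g = ≈-trans (⊕-cong (≈-refl {h 0 (suc N) ⊕ g 0 (suc N)}) (∑-⊕ N _ _))
  (⊕-interchange (h 0 (suc N)) (g 0 (suc N)) (antidiagonalSum N (λ a b → h (suc a) b))
                 (antidiagonalSum N (λ a b → g (suc a) b)))

∑-⊛ : ∀ N h z → antidiagonalSum N h ⊛ z ≈ ∑[ a + b ≡ N ] (h a b ⊛ z)
∑-⊛ zero    h z = ≈-refl
∑-⊛ (suc N) h z = ≈-trans (⊛-distribʳ z (h 0 (suc N)) _) (⊕-cong (≈-refl {h 0 (suc N) ⊛ z}) (∑-⊛ N _ z))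

∑-shiftˡ : ∀ N h → (∀ b → h 0 b ≈ zeroS) → antidiagonalSum (suc N) h ≈ ∑[ a + b ≡ N ] h (suc a) b
∑-shiftˡ N h h0≈0 = ≈-trans (⊕-cong (h0≈0 (suc N)) ≈-refl) (⊕-identityˡ _)

∑-shiftʳ : ∀ N h → (∀ a → h a 0 ≈ zeroS) → antidiagonalSum (suc N) h ≈ ∑[ a + b ≡ N ] h a (suc b)
∑-shiftʳ zero    h h≈0 = ≈-trans (⊕-cong (≈-refl {h 0 1}) (h≈0 1)) (⊕-identityʳ (h 0 1))
∑-shiftʳ (suc N) h h≈0 = ⊕-cong (≈-refl {h 0 (suc (suc N))}) (∑-shiftʳ N (λ a b → h (suc a) b) (h≈0 ∘ suc))

∑-coeff-zero : ∀ N h n → (∀ a b → a + b ≡ N → h a b n ≡ + 0) → antidiagonalSum N h n ≡ + 0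
∑-coeff-zero zero    h n h≡0 = h≡0 0 0 refl
∑-coeff-zero (suc N) h n h≡0 =
  cong₂ ℤ._+_ (h≡0 0 (suc N) refl) (∑-coeff-zero N _ n (λ a b a+b≡N → h≡0 (suc a) b (cong suc a+b≡N)))

∑-pascal : ∀ N T A B → T 0 (suc N) ≈ A 0 N → T (suc N) 0 ≈ B N 0 →
           (∀ a b → suc (a + b) ≡ N → T (suc a) (suc b) ≈ A (suc a) b ⊕ B a (suc b)) →
           antidiagonalSum (suc N) T ≈ antidiagonalSum N A ⊕ antidiagonalSum N B
∑-pascal N T A B first last middle = begin
  antidiagonalSum (suc N) T                               ≈⟨ ∑-cong (suc N) split ⟨
  ∑[ a + b ≡ suc N ] (U a b ⊕ V a b)                      ≈⟨ ∑-⊕ (suc N) U V ⟩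
  antidiagonalSum (suc N) U ⊕ antidiagonalSum (suc N) V   ≈⟨ ⊕-cong (∑-shiftʳ N U (λ _ → ≈-refl)) (∑-shiftˡ N V (λ _ → ≈-refl)) ⟩
  antidiagonalSum N A ⊕ antidiagonalSum N B               ∎
  where
  open ≈-Reasoning
  U V : ℕ → ℕ → Series
  U a zero    = zeroS
  U a (suc b) = A a b
  V zero    b = zeroS
  V (suc a) b = B a b
  split : ∀ a b → a + b ≡ suc N → U a b ⊕ V a b ≈ T a b
  split zero    (suc b) 1+b≡1+N with ℕP.suc-injective 1+b≡1+N
  ... | refl = ≈-trans (⊕-identityʳ (A 0 b)) (≈-sym first)
  split (suc a) zero    1+a+0≡1+N with trans (sym (ℕP.+-identityʳ a)) (ℕP.suc-injective 1+a+0≡1+N)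
  ... | refl = ≈-trans (⊕-identityˡ (B a 0)) (≈-sym last)
  split (suc a) (suc b) 2+a+b≡1+N =
    ≈-sym (middle a b (trans (sym (ℕP.+-suc a b)) (ℕP.suc-injective 2+a+b≡1+N)))

tri : ℕ → ℕ
tri zero    = 0
tri (suc a) = tri a + a

∏-^-tri : ∀ n x → ∏[ i < n ] (x ^ i) ≈ x ^ tri n
∏-^-tri zero    x = ≈-refl
∏-^-tri (suc n) x = ≈-trans (⊛-congʳ (x ^ n) (∏-^-tri n x)) (≈-sym (^-homo-* x (tri n) n))

module _ (Q : Series) where

  pochhammer : ℕ → Series
  pochhammer k = ∏[ i < k ] (oneS ⊖ Q ^ suc i)

  -- gaussian Q a b is the Gaussian binomial coefficient [a+b choose a]_Q, by q-Pascal recursion.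
  gaussian : ℕ → ℕ → Series
  gaussian zero    b       = oneS
  gaussian (suc a) zero    = oneS
  gaussian (suc a) (suc b) = gaussian (suc a) b ⊕ Q ^ suc b ⊛ gaussian a (suc b)

  gaussian-zeroʳ : ∀ a → gaussian a 0 ≈ oneS
  gaussian-zeroʳ zero    = ≈-refl
  gaussian-zeroʳ (suc a) = ≈-refl

  gaussian-pochhammer : ∀ a b → gaussian a b ⊛ (pochhammer a ⊛ pochhammer b) ≈ pochhammer (a + b)
  gaussian-pochhammer zero    b       = ≈-trans (⊛-identityˡ _) (⊛-identityˡ _)
  gaussian-pochhammer (suc a) zero    =
    ≈-trans (⊛-identityˡ _) (≈-trans (⊛-identityʳ _) (≈-reflexive (cong pochhammer (sym (ℕP.+-identityʳ (suc a))))))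
  gaussian-pochhammer (suc a) (suc b) = begin
    (G₁ ⊕ B ⊛ G₂) ⊛ ((Pa ⊛ (oneS ⊖ A)) ⊛ (Pb ⊛ (oneS ⊖ B)))
      ≈⟨ regroup G₁ G₂ Pa Pb A B ⟩
    (G₁ ⊛ (pochhammer (suc a) ⊛ Pb)) ⊛ (oneS ⊖ B) ⊕ B ⊛ ((G₂ ⊛ (Pa ⊛ pochhammer (suc b))) ⊛ (oneS ⊖ A))
      ≈⟨ ⊕-cong (⊛-congʳ (oneS ⊖ B) (gaussian-pochhammer (suc a) b))
                (⊛-congˡ B (⊛-congʳ (oneS ⊖ A) (≈-trans (gaussian-pochhammer a (suc b))
                                                        (≈-reflexive (cong pochhammer (ℕP.+-suc a b)))))) ⟩
    S ⊛ (oneS ⊖ B) ⊕ B ⊛ (S ⊛ (oneS ⊖ A))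
      ≈⟨ telescope S A B ⟩
    S ⊛ (oneS ⊖ B ⊛ A)
      ≈⟨ ⊛-congˡ S (⊕-cong (≈-refl {oneS}) (⊝-cong BA≈Q^)) ⟩
    pochhammer (suc (suc (a + b)))
      ≡⟨ cong pochhammer (cong suc (sym (ℕP.+-suc a b))) ⟩
    pochhammer (suc a + suc b) ∎
    where
    open ≈-Reasoning
    G₁ = gaussian (suc a) b
    G₂ = gaussian a (suc b)
    Pa = pochhammer a
    Pb = pochhammer b
    A  = Q ^ suc a
    B  = Q ^ suc b
    S  = pochhammer (suc (a + b))
    regroup : ∀ G₁ G₂ Pa Pb A B →
      (G₁ ⊕ B ⊛ G₂) ⊛ ((Pa ⊛ (oneS ⊖ A)) ⊛ (Pb ⊛ (oneS ⊖ B))) ≈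
      (G₁ ⊛ ((Pa ⊛ (oneS ⊖ A)) ⊛ Pb)) ⊛ (oneS ⊖ B) ⊕ B ⊛ ((G₂ ⊛ (Pa ⊛ (Pb ⊛ (oneS ⊖ B)))) ⊛ (oneS ⊖ A))
    regroup = solve 6 (λ G₁ G₂ Pa Pb A B →
      (G₁ :+ B :* G₂) :* ((Pa :* (con (+ 1) :- A)) :* (Pb :* (con (+ 1) :- B))) :=
      (G₁ :* ((Pa :* (con (+ 1) :- A)) :* Pb)) :* (con (+ 1) :- B) :+
      B :* ((G₂ :* (Pa :* (Pb :* (con (+ 1) :- B)))) :* (con (+ 1) :- A))) ≈-refl
    telescope : ∀ S A B → S ⊛ (oneS ⊖ B) ⊕ B ⊛ (S ⊛ (oneS ⊖ A)) ≈ S ⊛ (oneS ⊖ B ⊛ A)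
    telescope = solve 3 (λ S A B →
      S :* (con (+ 1) :- B) :+ B :* (S :* (con (+ 1) :- A)) := S :* (con (+ 1) :- B :* A)) ≈-refl
    BA≈Q^ : B ⊛ A ≈ Q ^ suc (suc (a + b))
    BA≈Q^ = begin
      Q ^ suc b ⊛ Q ^ suc a      ≈⟨ ^-homo-* Q (suc b) (suc a) ⟨
      Q ^ (suc b + suc a)        ≡⟨ cong (λ n → Q ^ suc n) (trans (ℕP.+-suc b a) (cong suc (ℕP.+-comm b a))) ⟩
      Q ^ suc (suc (a + b))      ∎

module _ (Q x y : Series) where

  cauchyTerm : ℕ → ℕ → Series
  cauchyTerm a b = Q ^ tri a ⊛ gaussian Q a b ⊛ x ^ a ⊛ y ^ b

  cauchyTerm-pascal : ∀ a b → cauchyTerm (suc a) (suc b) ≈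
                      cauchyTerm (suc a) b ⊛ y ⊕ cauchyTerm a (suc b) ⊛ (x ⊛ Q ^ suc (a + b))
  cauchyTerm-pascal a b = begin
    P₁ ⊛ (G₁ ⊕ B ⊛ G₂) ⊛ (x ⊛ Xa) ⊛ (y ⊛ Yb)
      ≈⟨ expand P₁ G₁ B G₂ Xa Yb ⟩
    P₁ ⊛ G₁ ⊛ (x ⊛ Xa) ⊛ Yb ⊛ y ⊕ (P₁ ⊛ B) ⊛ (G₂ ⊛ Xa ⊛ (y ⊛ Yb) ⊛ x)
      ≈⟨ ⊕-cong (≈-refl {P₁ ⊛ G₁ ⊛ (x ⊛ Xa) ⊛ Yb ⊛ y}) (⊛-congʳ (G₂ ⊛ Xa ⊛ (y ⊛ Yb) ⊛ x) exponents) ⟩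
    P₁ ⊛ G₁ ⊛ (x ⊛ Xa) ⊛ Yb ⊛ y ⊕ (P₀ ⊛ Qn) ⊛ (G₂ ⊛ Xa ⊛ (y ⊛ Yb) ⊛ x)
      ≈⟨ ⊕-cong (≈-refl {P₁ ⊛ G₁ ⊛ (x ⊛ Xa) ⊛ Yb ⊛ y}) (collect P₀ Qn G₂ Xa Yb) ⟩
    P₁ ⊛ G₁ ⊛ (x ⊛ Xa) ⊛ Yb ⊛ y ⊕ P₀ ⊛ G₂ ⊛ Xa ⊛ (y ⊛ Yb) ⊛ (x ⊛ Qn) ∎
    where
    open ≈-Reasoning
    P₀ = Q ^ tri a
    P₁ = Q ^ tri (suc a)
    Qn = Q ^ suc (a + b)
    B  = Q ^ suc b
    G₁ = gaussian Q (suc a) b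
    G₂ = gaussian Q a (suc b)
    Xa = x ^ a
    Yb = y ^ b
    expand : ∀ P₁ G₁ B G₂ Xa Yb → P₁ ⊛ (G₁ ⊕ B ⊛ G₂) ⊛ (x ⊛ Xa) ⊛ (y ⊛ Yb) ≈
             P₁ ⊛ G₁ ⊛ (x ⊛ Xa) ⊛ Yb ⊛ y ⊕ (P₁ ⊛ B) ⊛ (G₂ ⊛ Xa ⊛ (y ⊛ Yb) ⊛ x)
    expand P₁ G₁ B G₂ Xa Yb = solve 8 (λ P₁ G₁ B G₂ Xa Yb x y →
      P₁ :* (G₁ :+ B :* G₂) :* (x :* Xa) :* (y :* Yb) :=
      P₁ :* G₁ :* (x :* Xa) :* Yb :* y :+ (P₁ :* B) :* (G₂ :* Xa :* (y :* Yb) :* x)) ≈-refl P₁ G₁ B G₂ Xa Yb x y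
    collect : ∀ P₀ Qn G₂ Xa Yb → (P₀ ⊛ Qn) ⊛ (G₂ ⊛ Xa ⊛ (y ⊛ Yb) ⊛ x) ≈ P₀ ⊛ G₂ ⊛ Xa ⊛ (y ⊛ Yb) ⊛ (x ⊛ Qn)
    collect P₀ Qn G₂ Xa Yb = solve 7 (λ P₀ Qn G₂ Xa Yb x y →
      (P₀ :* Qn) :* (G₂ :* Xa :* (y :* Yb) :* x) := P₀ :* G₂ :* Xa :* (y :* Yb) :* (x :* Qn)) ≈-refl P₀ Qn G₂ Xa Yb x y
    exponents : P₁ ⊛ B ≈ P₀ ⊛ Qn
    exponents = begin
      Q ^ (tri a + a) ⊛ Q ^ suc b     ≈⟨ ^-homo-* Q (tri a + a) (suc b) ⟨
      Q ^ (tri a + a + suc b)         ≡⟨ cong (Q ^_) (trans (ℕP.+-assoc (tri a) a (suc b)) (cong (_+_ (tri a)) (ℕP.+-suc a b))) ⟩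
      Q ^ (tri a + suc (a + b))       ≈⟨ ^-homo-* Q (tri a) (suc (a + b)) ⟩
      Q ^ tri a ⊛ Q ^ suc (a + b)     ∎

  cauchyTerm-zero-suc : ∀ b → cauchyTerm 0 (suc b) ≈ cauchyTerm 0 b ⊛ y
  cauchyTerm-zero-suc b =
    solve 3 (λ o yᵇ y → o :* o :* o :* (y :* yᵇ) := o :* o :* o :* yᵇ :* y) ≈-refl oneS (y ^ b) y

  cauchyTerm-suc-zero : ∀ a → cauchyTerm (suc a) 0 ≈ cauchyTerm a 0 ⊛ (x ⊛ Q ^ a)
  cauchyTerm-suc-zero a = begin
    Q ^ (tri a + a) ⊛ oneS ⊛ (x ⊛ x ^ a) ⊛ oneS
      ≈⟨ ⊛-congʳ oneS (⊛-congʳ (x ⊛ x ^ a) (⊛-congʳ oneS (^-homo-* Q (tri a) a))) ⟩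
    Q ^ tri a ⊛ Q ^ a ⊛ oneS ⊛ (x ⊛ x ^ a) ⊛ oneS
      ≈⟨ solve 4 (λ P Qᵃ xᵃ x → P :* Qᵃ :* con (+ 1) :* (x :* xᵃ) :* con (+ 1) :=
                                P :* con (+ 1) :* xᵃ :* con (+ 1) :* (x :* Qᵃ)) ≈-refl (Q ^ tri a) (Q ^ a) (x ^ a) x ⟩
    Q ^ tri a ⊛ oneS ⊛ x ^ a ⊛ oneS ⊛ (x ⊛ Q ^ a)
      ≈⟨ ⊛-congʳ (x ⊛ Q ^ a) (⊛-congʳ oneS (⊛-congʳ (x ^ a) (⊛-congˡ (Q ^ tri a) (gaussian-zeroʳ Q a)))) ⟨
    cauchyTerm a 0 ⊛ (x ⊛ Q ^ a) ∎
    where open ≈-Reasoning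

  cauchy-binomial : ∀ N → ∏[ i < N ] (y ⊕ x ⊛ Q ^ i) ≈ ∑[ a + b ≡ N ] cauchyTerm a b
  cauchy-binomial zero    = solve 0 (con (+ 1) := con (+ 1) :* con (+ 1) :* con (+ 1) :* con (+ 1)) ≈-refl
  cauchy-binomial (suc N) = begin
    ∏[ i < N ] (y ⊕ x ⊛ Q ^ i) ⊛ (y ⊕ x ⊛ Q ^ N)
      ≈⟨ ⊛-congʳ (y ⊕ x ⊛ Q ^ N) (cauchy-binomial N) ⟩
    antidiagonalSum N cauchyTerm ⊛ (y ⊕ x ⊛ Q ^ N)
      ≈⟨ ⊛-distribˡ (antidiagonalSum N cauchyTerm) y (x ⊛ Q ^ N) ⟩
    antidiagonalSum N cauchyTerm ⊛ y ⊕ antidiagonalSum N cauchyTerm ⊛ (x ⊛ Q ^ N)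
      ≈⟨ ⊕-cong (∑-⊛ N cauchyTerm y) (∑-⊛ N cauchyTerm (x ⊛ Q ^ N)) ⟩
    ∑[ a + b ≡ N ] (cauchyTerm a b ⊛ y) ⊕ ∑[ a + b ≡ N ] (cauchyTerm a b ⊛ (x ⊛ Q ^ N))
      ≈⟨ ∑-pascal N cauchyTerm _ _ (cauchyTerm-zero-suc N) (cauchyTerm-suc-zero N) middle ⟨
    ∑[ a + b ≡ suc N ] cauchyTerm a b ∎
    where
    open ≈-Reasoning
    middle : ∀ a b → suc (a + b) ≡ N →
             cauchyTerm (suc a) (suc b) ≈ cauchyTerm (suc a) b ⊛ y ⊕ cauchyTerm a (suc b) ⊛ (x ⊛ Q ^ N)
    middle a b 1+a+b≡N = ≈-trans (cauchyTerm-pascal a b)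
      (⊕-cong (≈-refl {cauchyTerm (suc a) b ⊛ y}) (⊛-congˡ (cauchyTerm a (suc b)) (≈-reflexive (cong (λ n → x ⊛ Q ^ n) 1+a+b≡N))))

f≈pochhammer : ∀ d .{{_ : NonZero d}} k → f d ≈ pochhammer (q^ d) k mod-q^ suc k
f≈pochhammer d k = begin
  f d                                   ≈⟨ f≈∏ d k ⟩
  ∏[ i < k ] (oneS ⊖ q^ (d * suc i))    ≈⟨ ≈⇒≈mod (suc k) (∏-cong k (λ i _ → ⊕-cong (≈-refl {oneS}) (⊝-cong (q^-^ d (suc i))))) ⟨
  pochhammer (q^ d) k                   ∎
  where open ≈mod-Reasoning (suc k)

-- [a+b choose a] (q^d;q^d)_a (q^d;q^d)_b = (q^d;q^d)_(a+b), and each Pochhammer symbol agrees with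
-- f d up to its length.
gaussian-⊛-f : ∀ d .{{_ : NonZero d}} a b {M} → M ≤ suc a → M ≤ suc b →
               gaussian (q^ d) a b ⊛ f d ≈ oneS mod-q^ M
gaussian-⊛-f d a b {M} M≤1+a M≤1+b = begin
  G ⊛ f d                               ≈⟨ ≈⇒≈mod M cancel-fInv ⟨
  G ⊛ (f d ⊛ f d) ⊛ fInv d              ≈⟨ ⊛-cong-mod (⊛-cong-mod (≈mod-refl {G})
                                             (⊛-cong-mod (≈mod-mono M≤1+a (f≈pochhammer d a))
                                                         (≈mod-mono M≤1+b (f≈pochhammer d b))))
                                             (≈mod-refl {fInv d}) ⟩
  G ⊛ (P a ⊛ P b) ⊛ fInv d              ≈⟨ ≈⇒≈mod M (⊛-congʳ (fInv d) (gaussian-pochhammer (q^ d) a b)) ⟩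
  P (a + b) ⊛ fInv d                    ≈⟨ ⊛-cong-mod (≈mod-mono (ℕP.≤-trans M≤1+a (s≤s (ℕP.m≤m+n a b))) (f≈pochhammer d (a + b)))
                                                      (≈mod-refl {fInv d}) ⟨
  f d ⊛ fInv d                          ≈⟨ ≈⇒≈mod M (f⊛fInv d) ⟩
  oneS                                  ∎
  where
  open ≈mod-Reasoning M
  G = gaussian (q^ d) a b
  P = pochhammer (q^ d)
  cancel-fInv : G ⊛ (f d ⊛ f d) ⊛ fInv d ≈ G ⊛ f d
  cancel-fInv = ≈-trans (⊛-congʳ (fInv d) (≈-sym (⊛-assoc G (f d) (f d)))) (⊛-f⊛fInv d (G ⊛ f d))

-- Triangular numbers

tri-+ : ∀ m n → tri (m + n) ≡ tri m + tri n + m * n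
tri-+ m zero    = trans (cong tri (ℕP.+-identityʳ m)) (sym (zero-terms (tri m) m))
  where
  zero-terms : ∀ t m → t + 0 + m * 0 ≡ t
  zero-terms = solve-∀
tri-+ m (suc n) = begin
  tri (m + suc n)                     ≡⟨ cong tri (ℕP.+-suc m n) ⟩
  tri (m + n) + (m + n)               ≡⟨ cong (_+ (m + n)) (tri-+ m n) ⟩
  tri m + tri n + m * n + (m + n)     ≡⟨ regroup (tri m) (tri n) m n ⟩
  tri m + tri (suc n) + m * suc n     ∎
  where
  open ≡-Reasoning
  regroup : ∀ tm tn m n → tm + tn + m * n + (m + n) ≡ tm + (tn + n) + m * suc n
  regroup = solve-∀

tri-sq : ∀ m → 2 * tri m + m ≡ m * m
tri-sq zero    = refl
tri-sq (suc m) = begin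
  2 * (tri m + m) + suc m          ≡⟨ regroup (tri m) m ⟩
  2 * tri m + m + (2 * m + 1)      ≡⟨ cong (_+ (2 * m + 1)) (tri-sq m) ⟩
  m * m + (2 * m + 1)              ≡⟨ square m ⟩
  suc m * suc m                    ∎
  where
  open ≡-Reasoning
  regroup : ∀ t m → 2 * (t + m) + suc m ≡ 2 * t + m + (2 * m + 1)
  regroup = solve-∀
  square : ∀ m → m * m + (2 * m + 1) ≡ suc m * suc m
  square = solve-∀

tri-double : ∀ m → tri (m + m) ≡ 4 * tri m + m
tri-double m = begin
  tri (m + m)                      ≡⟨ tri-+ m m ⟩
  tri m + tri m + m * m            ≡⟨ cong (_+_ (tri m + tri m)) (tri-sq m) ⟨
  tri m + tri m + (2 * tri m + m)  ≡⟨ collect (tri m) m ⟩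
  4 * tri m + m                    ∎
  where
  open ≡-Reasoning
  collect : ∀ t m → t + t + (2 * t + m) ≡ 4 * t + m
  collect = solve-∀

tri-double-≥ : ∀ u → u ≤ tri (u + u)
tri-double-≥ u = subst (u ≤_) (sym (tri-double u)) (ℕP.m≤n+m u (4 * tri u))

tri%3≢2 : ∀ m → tri m % 3 ≢ 2
tri%3≢2 0 ()
tri%3≢2 1 ()
tri%3≢2 2 ()
tri%3≢2 (suc (suc (suc m))) tri[3+m]%3≡2 = tri%3≢2 m (begin
  tri m % 3                              ≡⟨ [m+kn]%n≡m%n (tri m) (suc m) 3 ⟨
  (tri m + suc m * 3) % 3                ≡⟨ cong (_% 3) (three-steps (tri m) m) ⟨
  tri (suc (suc (suc m))) % 3            ≡⟨ tri[3+m]%3≡2 ⟩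
  2                                      ∎)
  where
  open ≡-Reasoning
  three-steps : ∀ t m → t + m + suc m + suc (suc m) ≡ t + suc m * 3
  three-steps = solve-∀

-- The exponent of q in cauchyTerm (q^ 4) -1ₛ (q^ (4 * n + 3)) a b.
cauchyExponent : ℕ → ℕ → ℕ → ℕ
cauchyExponent n a b = 4 * tri a + (4 * n + 3) * b

exponent-offset-above : ∀ n a b u → a ≡ suc n + u → b + u ≡ suc n →
  cauchyExponent n a b ≡ cauchyExponent n (suc n) (suc n) + tri (u + u)
exponent-offset-above n _ b u refl b+u≡1+n = begin
  4 * tri (suc n + u) + c * b                              ≡⟨ cong (λ t → 4 * t + c * b) (tri-+ (suc n) u) ⟩
  4 * (tri (suc n) + tri u + suc n * u) + c * b            ≡⟨ regroup (tri (suc n)) (tri u) n u b ⟩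
  4 * tri (suc n) + c * (b + u) + (4 * tri u + u)          ≡⟨ cong₂ (λ p t → 4 * tri (suc n) + c * p + t) b+u≡1+n (sym (tri-double u)) ⟩
  4 * tri (suc n) + c * suc n + tri (u + u)                ∎
  where
  open ≡-Reasoning
  c = 4 * n + 3
  regroup : ∀ T t n u b → 4 * (T + t + suc n * u) + (4 * n + 3) * b ≡ 4 * T + (4 * n + 3) * (b + u) + (4 * t + u)
  regroup = solve-∀

exponent-offset-below : ∀ n a b w → a + suc w ≡ suc n → b ≡ suc n + suc w →
  cauchyExponent n a b ≡ cauchyExponent n (suc n) (suc n) + tri (suc (suc w + suc w))
exponent-offset-below n a _ w a+1+w≡1+n refl with ℕP.suc-injective (trans (sym (ℕP.+-suc a w)) a+1+w≡1+n)
... | refl = begin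
  4 * tri a + c * (suc (a + w) + suc w)                    ≡⟨ expand (tri a) a w ⟩
  R + 4 * (w * w)                                          ≡⟨ cong (λ s → R + 4 * s) (tri-sq w) ⟨
  R + 4 * (2 * tri w + w)                                  ≡⟨ collect (tri a) (tri w) a w ⟩
  4 * (tri a + tri w + a * w + (a + w)) + c * suc (a + w) + (4 * (tri w + w) + suc w + (suc w + suc w))
    ≡⟨ cong₂ (λ s t → 4 * (s + (a + w)) + c * suc (a + w) + (t + (suc w + suc w))) (tri-+ a w) (tri-double (suc w)) ⟨
  4 * tri (suc (a + w)) + c * suc (a + w) + tri (suc (suc w + suc w)) ∎
  where
  open ≡-Reasoning
  c = 4 * (a + w) + 3
  R = 4 * tri a + c * suc (a + w) + 4 * a * w + 4 * a + 7 * w + 3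
  expand : ∀ T a w → 4 * T + (4 * (a + w) + 3) * (suc (a + w) + suc w) ≡
                     4 * T + (4 * (a + w) + 3) * suc (a + w) + 4 * a * w + 4 * a + 7 * w + 3 + 4 * (w * w)
  expand = solve-∀
  collect : ∀ T t a w →
    4 * T + (4 * (a + w) + 3) * suc (a + w) + 4 * a * w + 4 * a + 7 * w + 3 + 4 * (2 * t + w) ≡
    4 * (T + t + a * w + (a + w)) + (4 * (a + w) + 3) * suc (a + w) + (4 * (t + w) + suc w + (suc w + suc w))
  collect = solve-∀

-- Completing the square: with K = a - (n + 1) the exponent exceeds that of the middle term by
-- 2K² - K, which is tri (2K) for K ≥ 0 and tri (1 - 2K) for K < 0.
exponent-offset : ∀ n a b → a + b ≡ suc n + suc n →
  Σ[ m ∈ ℕ ] (cauchyExponent n a b ≡ cauchyExponent n (suc n) (suc n) + tri m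
             × suc n ≤ tri m + a × suc n ≤ tri m + b)
exponent-offset n a b a+b≡2p with suc n ℕP.≤? a
... | yes p≤a = u + u , exponent-offset-above n a b u a≡p+u b+u≡p ,
                ℕP.≤-trans p≤a (ℕP.m≤n+m a (tri (u + u))) ,
                subst (_≤ tri (u + u) + b) (trans (ℕP.+-comm u b) b+u≡p)
                      (ℕP.+-monoˡ-≤ b (tri-double-≥ u))
  where
  u = a ∸ suc n
  a≡p+u : a ≡ suc n + u
  a≡p+u = sym (ℕP.m+[n∸m]≡n p≤a)
  b+u≡p : b + u ≡ suc n
  b+u≡p = trans (ℕP.+-comm b u) (ℕP.+-cancelˡ-≡ (suc n) (u + b) (suc n)
            (trans (sym (ℕP.+-assoc (suc n) u b)) (trans (cong (_+ b) (sym a≡p+u)) a+b≡2p)))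
... | no p≰a = suc (W + W) , exponent-offset-below n a b w a+W≡p b≡p+W ,
               subst (_≤ tri (suc (W + W)) + a) (trans (ℕP.+-comm W a) a+W≡p)
                     (ℕP.+-monoˡ-≤ a (ℕP.≤-trans (tri-double-≥ W) (ℕP.m≤m+n _ (W + W)))) ,
               subst (suc n ≤_) (sym (cong (_+_ (tri (suc (W + W)))) b≡p+W))
                     (ℕP.≤-trans (ℕP.m≤m+n (suc n) W) (ℕP.m≤n+m (suc n + W) _))
  where
  w = n ∸ a
  W = suc w
  a+W≡p : a + W ≡ suc n
  a+W≡p = trans (ℕP.+-suc a w) (cong suc (ℕP.m+[n∸m]≡n (ℕP.≤-pred (ℕP.≰⇒> p≰a))))
  b≡p+W : b ≡ suc n + W
  b≡p+W = ℕP.+-cancelˡ-≡ a b (suc n + W)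
            (trans a+b≡2p (trans (cong (_+ suc n) (sym a+W≡p))
              (trans (ℕP.+-assoc a W (suc n)) (cong (_+_ a) (ℕP.+-comm W (suc n))))))

-- The vanishing of ψ(-q) at exponents 2 modulo 3

oddProduct : ℕ → Series
oddProduct k = ∏[ i < k ] (oneS ⊖ q^ (2 * i + 1))

evenProduct : ℕ → Series
evenProduct k = ∏[ i < k ] (oneS ⊖ q^ (2 * suc i))

oddProduct-split : ∀ p → oddProduct (p + p) ≈ ∏[ i < p ] (oneS ⊖ q^ (4 * i + 1)) ⊛ ∏[ i < p ] (oneS ⊖ q^ (4 * i + 3))
oddProduct-split p = ≈-trans (∏-interleave p (λ j → oneS ⊖ q^ (2 * j + 1)))
  (⊛-cong (∏-cong p (λ i _ → ≈-reflexive (cong (λ m → oneS ⊖ q^ m) (even i))))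
          (∏-cong p (λ i _ → ≈-reflexive (cong (λ m → oneS ⊖ q^ m) (odd i)))))
  where
  even : ∀ i → 2 * (i + i) + 1 ≡ 4 * i + 1
  even = solve-∀
  odd : ∀ i → 2 * suc (i + i) + 1 ≡ 4 * i + 3
  odd = solve-∀

cauchy-lhs-factor≤ : ∀ n i → i ≤ n →
  q^ (4 * n + 3) ⊕ -1ₛ ⊛ (q^ 4) ^ i ≈ -1ₛ ⊛ q^ (4 * i) ⊛ (oneS ⊖ q^ (4 * (n ∸ i) + 3))
cauchy-lhs-factor≤ n i i≤n = begin
  q^ (4 * n + 3) ⊕ -1ₛ ⊛ (q^ 4) ^ i                  ≈⟨ ⊕-cong (≈-reflexive (cong q^_ split)) (⊛-congˡ -1ₛ (q^-^ 4 i)) ⟩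
  q^ (4 * i + (4 * (n ∸ i) + 3)) ⊕ -1ₛ ⊛ q^ (4 * i)  ≈⟨ q^[m+k]-q^m (4 * i) (4 * (n ∸ i) + 3) ⟩
  -1ₛ ⊛ q^ (4 * i) ⊛ (oneS ⊖ q^ (4 * (n ∸ i) + 3))   ∎
  where
  open ≈-Reasoning
  distribute : ∀ i d → 4 * (i + d) + 3 ≡ 4 * i + (4 * d + 3)
  distribute = solve-∀
  split : 4 * n + 3 ≡ 4 * i + (4 * (n ∸ i) + 3)
  split = trans (cong (λ m → 4 * m + 3) (sym (ℕP.m+[n∸m]≡n i≤n))) (distribute i (n ∸ i))

cauchy-lhs-factor> : ∀ n i →
  q^ (4 * n + 3) ⊕ -1ₛ ⊛ (q^ 4) ^ (suc n + i) ≈ q^ (4 * n + 3) ⊛ (oneS ⊖ q^ (4 * i + 1))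
cauchy-lhs-factor> n i = begin
  q^ (4 * n + 3) ⊕ -1ₛ ⊛ (q^ 4) ^ (suc n + i)
    ≈⟨ ⊕-cong (≈-refl {q^ (4 * n + 3)}) (⊛-congˡ -1ₛ (q^-^ 4 (suc n + i))) ⟩
  q^ (4 * n + 3) ⊕ -1ₛ ⊛ q^ (4 * (suc n + i))
    ≡⟨ cong (λ m → q^ (4 * n + 3) ⊕ -1ₛ ⊛ q^ m) (split n i) ⟩
  q^ (4 * n + 3) ⊕ -1ₛ ⊛ q^ (4 * n + 3 + (4 * i + 1))
    ≈⟨ q^m-q^[m+k] (4 * n + 3) (4 * i + 1) ⟩
  q^ (4 * n + 3) ⊛ (oneS ⊖ q^ (4 * i + 1)) ∎
  where
  open ≈-Reasoning
  split : ∀ n i → 4 * (suc n + i) ≡ 4 * n + 3 + (4 * i + 1)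
  split = solve-∀

-- The first n + 1 factors are -q^(4i) (1 - q^(4(n-i)+3)), the others q^(4n+3) (1 - q^(4i+1)).
cauchy-lhs : ∀ n → ∏[ i < suc n + suc n ] (q^ (4 * n + 3) ⊕ -1ₛ ⊛ (q^ 4) ^ i) ≈
                   -1ₛ ^ suc n ⊛ q^ (cauchyExponent n (suc n) (suc n)) ⊛ oddProduct (suc n + suc n)
cauchy-lhs n = begin
  ∏ (p + p) L
    ≈⟨ ∏-+ p p L ⟩
  ∏ p L ⊛ ∏[ i < p ] L (p + i)
    ≈⟨ ⊛-cong lower upper ⟩
  -1ₛ ^ p ⊛ q^ (4 * tri p) ⊛ O₃ ⊛ (q^ (c * p) ⊛ O₁)
    ≈⟨ regroup (-1ₛ ^ p) (q^ (4 * tri p)) O₃ (q^ (c * p)) O₁ ⟩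
  -1ₛ ^ p ⊛ (q^ (4 * tri p) ⊛ q^ (c * p)) ⊛ (O₁ ⊛ O₃)
    ≈⟨ ⊛-cong (⊛-congˡ (-1ₛ ^ p) (q^-+ (4 * tri p) (c * p))) (oddProduct-split p) ⟨
  -1ₛ ^ p ⊛ q^ (4 * tri p + c * p) ⊛ oddProduct (p + p) ∎
  where
  open ≈-Reasoning
  p = suc n
  c = 4 * n + 3
  L : ℕ → Series
  L i = q^ c ⊕ -1ₛ ⊛ (q^ 4) ^ i
  O₁ = ∏[ i < p ] (oneS ⊖ q^ (4 * i + 1))
  O₃ = ∏[ i < p ] (oneS ⊖ q^ (4 * i + 3))
  regroup : ∀ s t o₃ u o₁ → s ⊛ t ⊛ o₃ ⊛ (u ⊛ o₁) ≈ s ⊛ (t ⊛ u) ⊛ (o₁ ⊛ o₃)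
  regroup = solve 5 (λ s t o₃ u o₁ → s :* t :* o₃ :* (u :* o₁) := s :* (t :* u) :* (o₁ :* o₃)) ≈-refl
  powers : ∏[ i < p ] q^ (4 * i) ≈ q^ (4 * tri p)
  powers = ≈-trans (∏-cong p (λ i _ → ≈-sym (q^-^ 4 i))) (≈-trans (∏-^-tri p (q^ 4)) (q^-^ 4 (tri p)))
  lower : ∏ p L ≈ -1ₛ ^ p ⊛ q^ (4 * tri p) ⊛ O₃
  lower = begin
    ∏ p L
      ≈⟨ ∏-cong p (λ i i<p → cauchy-lhs-factor≤ n i (ℕP.≤-pred i<p)) ⟩
    ∏[ i < p ] (-1ₛ ⊛ q^ (4 * i) ⊛ (oneS ⊖ q^ (4 * (n ∸ i) + 3)))
      ≈⟨ ∏-⊛ p _ _ ⟩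
    ∏[ i < p ] (-1ₛ ⊛ q^ (4 * i)) ⊛ ∏[ i < p ] (oneS ⊖ q^ (4 * (n ∸ i) + 3))
      ≈⟨ ⊛-cong (≈-trans (∏-⊛ p _ _) (⊛-cong (∏-const p -1ₛ) powers))
                (∏-reverse p (λ j → oneS ⊖ q^ (4 * j + 3))) ⟩
    -1ₛ ^ p ⊛ q^ (4 * tri p) ⊛ O₃ ∎
  upper : ∏[ i < p ] L (p + i) ≈ q^ (c * p) ⊛ O₁
  upper = begin
    ∏[ i < p ] L (p + i)                          ≈⟨ ∏-cong p (λ i _ → cauchy-lhs-factor> n i) ⟩
    ∏[ i < p ] (q^ c ⊛ (oneS ⊖ q^ (4 * i + 1)))   ≈⟨ ∏-⊛ p _ _ ⟩
    ∏[ i < p ] q^ c ⊛ O₁                          ≈⟨ ⊛-congʳ O₁ (≈-trans (∏-const p (q^ c)) (q^-^ c p)) ⟩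
    q^ (c * p) ⊛ O₁                               ∎

-1ₛ^-⊛ : ∀ k W → -1ₛ ^ k ⊛ W ≈ W ⊎ -1ₛ ^ k ⊛ W ≈ ⊝ W
-1ₛ^-⊛ zero    W = inj₁ (⊛-identityˡ W)
-1ₛ^-⊛ (suc k) W with -1ₛ^-⊛ k W
... | inj₁ ≈W  = inj₂ (≈-trans (⊛-assoc -1ₛ (-1ₛ ^ k) W) (≈-trans (⊛-congˡ -1ₛ ≈W) (negate W)))
  where
  negate : ∀ W → -1ₛ ⊛ W ≈ ⊝ W
  negate = solve 1 (λ w → (:- con (+ 1)) :* w := :- w) ≈-refl
... | inj₂ ≈⊝W = inj₁ (≈-trans (⊛-assoc -1ₛ (-1ₛ ^ k) W) (≈-trans (⊛-congˡ -1ₛ ≈⊝W) (negate² W)))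
  where
  negate² : ∀ W → -1ₛ ⊛ (⊝ W) ≈ W
  negate² = solve 1 (λ w → (:- con (+ 1)) :* (:- w) := w) ≈-refl

-1ₛ^-⊛-coeff≡0 : ∀ k W n → (-1ₛ ^ k ⊛ W) n ≡ + 0 ⇔ W n ≡ + 0
-1ₛ^-⊛-coeff≡0 k W n with -1ₛ^-⊛ k W
... | inj₁ ≈W  = mk⇔ (trans (sym (coeff ≈W n))) (trans (coeff ≈W n))
... | inj₂ ≈⊝W = mk⇔ (λ eq → ℤP.neg-injective (trans (sym (coeff ≈⊝W n)) eq))
                     (λ eq → trans (coeff ≈⊝W n) (cong ℤ.-_ eq))

cauchyTerm-⊛-f₄ : ∀ n a b → cauchyTerm (q^ 4) -1ₛ (q^ (4 * n + 3)) a b ⊛ f 4 ≈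
                           -1ₛ ^ a ⊛ (q^ (cauchyExponent n a b) ⊛ (gaussian (q^ 4) a b ⊛ f 4))
cauchyTerm-⊛-f₄ n a b = begin
  (q^ 4) ^ tri a ⊛ G ⊛ -1ₛ ^ a ⊛ (q^ c) ^ b ⊛ f 4
    ≈⟨ ⊛-congʳ (f 4) (⊛-cong (⊛-congʳ (-1ₛ ^ a) (⊛-congʳ G (q^-^ 4 (tri a)))) (q^-^ c b)) ⟩
  q^ (4 * tri a) ⊛ G ⊛ -1ₛ ^ a ⊛ q^ (c * b) ⊛ f 4
    ≈⟨ regroup (q^ (4 * tri a)) G (-1ₛ ^ a) (q^ (c * b)) (f 4) ⟩
  -1ₛ ^ a ⊛ (q^ (4 * tri a) ⊛ q^ (c * b) ⊛ (G ⊛ f 4))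
    ≈⟨ ⊛-congˡ (-1ₛ ^ a) (⊛-congʳ (G ⊛ f 4) (q^-+ (4 * tri a) (c * b))) ⟨
  -1ₛ ^ a ⊛ (q^ (4 * tri a + c * b) ⊛ (G ⊛ f 4)) ∎
  where
  open ≈-Reasoning
  c = 4 * n + 3
  G = gaussian (q^ 4) a b
  regroup : ∀ A G s B F → A ⊛ G ⊛ s ⊛ B ⊛ F ≈ s ⊛ (A ⊛ B ⊛ (G ⊛ F))
  regroup = solve 5 (λ A G s B F → A :* G :* s :* B :* F := s :* (A :* B :* (G :* F))) ≈-refl

ψ[-q] : Series
ψ[-q] = f 1 ⊛ f 4 ⊛ fInv 2

f₁≈odd⊛even : ∀ k → f 1 ≈ oddProduct k ⊛ evenProduct k mod-q^ suc k
f₁≈odd⊛even k = ≈mod-mono (s≤s (ℕP.m≤m+n k k)) (begin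
  f 1                                           ≈⟨ f≈∏ 1 (k + k) ⟩
  ∏[ i < k + k ] (oneS ⊖ q^ (1 * suc i))        ≈⟨ ≈⇒≈mod (suc (k + k)) (≈-trans (∏-interleave k _) parity) ⟩
  oddProduct k ⊛ evenProduct k                  ∎)
  where
  open ≈mod-Reasoning (suc (k + k))
  odd : ∀ i → 1 * suc (i + i) ≡ 2 * i + 1
  odd = solve-∀
  even : ∀ i → 1 * suc (suc (i + i)) ≡ 2 * suc i
  even = solve-∀
  parity : ∏[ i < k ] (oneS ⊖ q^ (1 * suc (i + i))) ⊛ ∏[ i < k ] (oneS ⊖ q^ (1 * suc (suc (i + i)))) ≈
           oddProduct k ⊛ evenProduct k
  parity = ⊛-cong (∏-cong k (λ i _ → ≈-reflexive (cong (λ m → oneS ⊖ q^ m) (odd i))))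
                  (∏-cong k (λ i _ → ≈-reflexive (cong (λ m → oneS ⊖ q^ m) (even i))))

ψ[-q]≈oddProduct⊛f₄ : ∀ k → ψ[-q] ≈ oddProduct k ⊛ f 4 mod-q^ suc k
ψ[-q]≈oddProduct⊛f₄ k = begin
  f 1 ⊛ f 4 ⊛ fInv 2
    ≈⟨ ⊛-cong-mod (⊛-cong-mod (f₁≈odd⊛even k) (≈mod-refl {f 4})) (≈mod-refl {fInv 2}) ⟩
  oddProduct k ⊛ evenProduct k ⊛ f 4 ⊛ fInv 2
    ≈⟨ ⊛-cong-mod (⊛-cong-mod (⊛-cong-mod (≈mod-refl {oddProduct k}) (f≈∏ 2 k)) (≈mod-refl {f 4}))
                  (≈mod-refl {fInv 2}) ⟨
  oddProduct k ⊛ f 2 ⊛ f 4 ⊛ fInv 2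
    ≈⟨ ≈⇒≈mod (suc k) (⊛-congʳ (fInv 2) (xy∙z≈xz∙y (oddProduct k) (f 2) (f 4))) ⟩
  oddProduct k ⊛ f 4 ⊛ f 2 ⊛ fInv 2
    ≈⟨ ≈⇒≈mod (suc k) (⊛-f⊛fInv 2 (oddProduct k ⊛ f 4)) ⟩
  oddProduct k ⊛ f 4 ∎
  where open ≈mod-Reasoning (suc k)

jacobi-expansion : ∀ N →
  -1ₛ ^ suc N ⊛ (q^ (cauchyExponent N (suc N) (suc N)) ⊛ (oddProduct (suc N + suc N) ⊛ f 4)) ≈
  ∑[ a + b ≡ suc N + suc N ] (cauchyTerm (q^ 4) -1ₛ (q^ (4 * N + 3)) a b ⊛ f 4)
jacobi-expansion N = begin
  -1ₛ ^ p ⊛ (q^ E ⊛ (oddProduct k ⊛ f 4))       ≈⟨ regroup (-1ₛ ^ p) (q^ E) (oddProduct k) (f 4) ⟩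
  -1ₛ ^ p ⊛ q^ E ⊛ oddProduct k ⊛ f 4           ≈⟨ ⊛-congʳ (f 4) (cauchy-lhs N) ⟨
  ∏[ i < k ] (q^ c ⊕ -1ₛ ⊛ (q^ 4) ^ i) ⊛ f 4    ≈⟨ ⊛-congʳ (f 4) (cauchy-binomial (q^ 4) -1ₛ (q^ c) k) ⟩
  antidiagonalSum k T ⊛ f 4                     ≈⟨ ∑-⊛ k T (f 4) ⟩
  ∑[ a + b ≡ k ] (T a b ⊛ f 4)                   ∎
  where
  open ≈-Reasoning
  p = suc N
  k = p + p
  c = 4 * N + 3
  E = cauchyExponent N p p
  T = cauchyTerm (q^ 4) -1ₛ (q^ c)
  regroup : ∀ s u o F → s ⊛ (u ⊛ (o ⊛ F)) ≈ s ⊛ u ⊛ o ⊛ F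
  regroup = solve 4 (λ s u o F → s :* (u :* (o :* F)) := s :* u :* o :* F) ≈-refl

cauchyTerm-⊛-f₄-coeff≡0 : ∀ N a b → N % 3 ≡ 2 → a + b ≡ suc N + suc N →
  (cauchyTerm (q^ 4) -1ₛ (q^ (4 * N + 3)) a b ⊛ f 4) (cauchyExponent N (suc N) (suc N) + N) ≡ + 0
cauchyTerm-⊛-f₄-coeff≡0 N a b N%3≡2 a+b≡k with exponent-offset N a b a+b≡k
... | m , e≡E+tri , p≤tri+a , p≤tri+b =
  trans (coeff (cauchyTerm-⊛-f₄ N a b) (E + N))
        (Equivalence.from (-1ₛ^-⊛-coeff≡0 a (q^ (cauchyExponent N a b) ⊛ H) (E + N)) (begin
    (q^ (cauchyExponent N a b) ⊛ H) (E + N)   ≡⟨ cong (λ e → (q^ e ⊛ H) (E + N)) e≡E+tri ⟩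
    (q^ (E + tri m) ⊛ H) (E + N)              ≡⟨ q^-+-⊛-coeff E (tri m) H N ⟩
    (q^ tri m ⊛ H) N                          ≡⟨ q^-⊛-coeff≡0 (tri m) H N tri≢N H≈1 ⟩
    + 0                                       ∎))
  where
  open ≡-Reasoning
  E = cauchyExponent N (suc N) (suc N)
  H = gaussian (q^ 4) a b ⊛ f 4
  tri≢N : tri m ≢ N
  tri≢N tri≡N = tri%3≢2 m (trans (cong (_% 3) tri≡N) N%3≡2)
  H≈1 : H ≈ oneS mod-q^ (suc N ∸ tri m)
  H≈1 = gaussian-⊛-f 4 a b (ℕP.≤-trans (ℕP.m≤n+o⇒m∸n≤o (suc N) (tri m) p≤tri+a) (ℕP.n≤1+n a))
                           (ℕP.≤-trans (ℕP.m≤n+o⇒m∸n≤o (suc N) (tri m) p≤tri+b) (ℕP.n≤1+n b))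

ψ[-q]-coeff≡0 : ∀ N → N % 3 ≡ 2 → ψ[-q] N ≡ + 0
ψ[-q]-coeff≡0 N N%3≡2 = begin
  ψ[-q] N                  ≡⟨ coeff< (ψ[-q]≈oddProduct⊛f₄ k) N (s≤s (ℕP.≤-trans (ℕP.n≤1+n N) (ℕP.m≤m+n p p))) ⟩
  Z N                      ≡⟨ q^-⊛-coeff-+ E Z N ⟨
  (q^ E ⊛ Z) (E + N)       ≡⟨ Equivalence.to (-1ₛ^-⊛-coeff≡0 p (q^ E ⊛ Z) (E + N)) signed ⟩
  + 0                      ∎
  where
  open ≡-Reasoning
  p = suc N
  k = p + p
  E = cauchyExponent N p p
  Z = oddProduct k ⊛ f 4
  signed : (-1ₛ ^ p ⊛ (q^ E ⊛ Z)) (E + N) ≡ + 0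
  signed = trans (coeff (jacobi-expansion N) (E + N))
                 (∑-coeff-zero k (λ a b → cauchyTerm (q^ 4) -1ₛ (q^ (4 * N + 3)) a b ⊛ f 4) (E + N)
                   (λ a b → cauchyTerm-⊛-f₄-coeff≡0 N a b N%3≡2))

3∣CoeffsAt-ψ[-q] : 3∣CoeffsAt 2 ψ[-q]
3∣CoeffsAt-ψ[-q] = 3∣coeffsAt λ n n%3≡2 →
  subst (+ 3 Signed.∣_) (sym (ψ[-q]-coeff≡0 n n%3≡2)) (divides (+ 0) refl)

+[3m+c] : ∀ m c → + (3 * m + c) ≡ + 3 ℤ.* + m ℤ.+ + c
+[3m+c] m c = trans (ℤP.pos-+ (3 * m) c) (cong (ℤ._+ + c) (ℤP.pos-* 3 m))

abar[3d+3,3k+6]-InQ³ : ∀ d k → InQ³Mod3 (abar (3 * d + 3) (3 * k + 6))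
abar[3d+3,3k+6]-InQ³ d k =
  ∼₃-InQ³ (⊛-InQ³ (⊛-InQ³ oneS-InQ³ oneS-InQ³) oneS-InQ³) (abar-∼₃ (3 * d + 3) (3 * k + 6)
  (+ 3 ℤ.* + k ℤ.- + 2 ℤ.* + d ℤ.+ + 4) (ℤ.- (+ 2 ℤ.* + k ℤ.+ + 4)) (+ d ℤ.- + k ℤ.- + 1) 0 0 0
  (trans (cong₂ (λ S R → + 3 ℤ.* S ℤ.- + 2 ℤ.* R) (+[3m+c] k 6) (+[3m+c] d 3)) (e₁ (+ d) (+ k)))
  (trans (cong (λ S → ℤ.- (+ 2 ℤ.* S)) (+[3m+c] k 6)) (e₂ (+ k)))
  (trans (cong₂ ℤ._-_ (+[3m+c] d 3) (+[3m+c] k 6)) (e₃ (+ d) (+ k))))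
  where
  e₁ : ∀ D K → + 3 ℤ.* (+ 3 ℤ.* K ℤ.+ + 6) ℤ.- + 2 ℤ.* (+ 3 ℤ.* D ℤ.+ + 3) ≡
               + 3 ℤ.* (+ 3 ℤ.* K ℤ.- + 2 ℤ.* D ℤ.+ + 4) ℤ.+ + 0
  e₁ = ℤSolver.solve-∀
  e₂ : ∀ K → ℤ.- (+ 2 ℤ.* (+ 3 ℤ.* K ℤ.+ + 6)) ≡ + 3 ℤ.* ℤ.- (+ 2 ℤ.* K ℤ.+ + 4) ℤ.+ + 0
  e₂ = ℤSolver.solve-∀
  e₃ : ∀ D K → + 3 ℤ.* D ℤ.+ + 3 ℤ.- (+ 3 ℤ.* K ℤ.+ + 6) ≡ + 3 ℤ.* (D ℤ.- K ℤ.- + 1) ℤ.+ + 0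
  e₃ = ℤSolver.solve-∀

abar[3d+5,3k+1]∼₃ψ[-q] : ∀ d k → abar (3 * d + 5) (3 * k + 1) ∼₃ ψ[-q]
abar[3d+5,3k+1]∼₃ψ[-q] d k = ∼₃-trans (abar-∼₃ (3 * d + 5) (3 * k + 1)
  (+ 3 ℤ.* + k ℤ.- + 2 ℤ.* + d ℤ.- + 3) (ℤ.- (+ 2 ℤ.* + k ℤ.+ + 1)) (+ d ℤ.- + k ℤ.+ + 1) 2 1 1
  (trans (cong₂ (λ S R → + 3 ℤ.* S ℤ.- + 2 ℤ.* R) (+[3m+c] k 1) (+[3m+c] d 5)) (e₁ (+ d) (+ k)))
  (trans (cong (λ S → ℤ.- (+ 2 ℤ.* S)) (+[3m+c] k 1)) (e₂ (+ k)))
  (trans (cong₂ ℤ._-_ (+[3m+c] d 5) (+[3m+c] k 1)) (e₃ (+ d) (+ k))))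
  (factor (f 2 ^ 3) (cube-InQ³ (f 2)) (begin
    f 2 ^ 2 ⊛ f 1 ^ 1 ⊛ f 4 ^ 1                       ≈⟨ ⊛-identityʳ _ ⟨
    f 2 ^ 2 ⊛ f 1 ^ 1 ⊛ f 4 ^ 1 ⊛ oneS                ≈⟨ ⊛-congˡ (f 2 ^ 2 ⊛ f 1 ^ 1 ⊛ f 4 ^ 1) (f⊛fInv 2) ⟨
    f 2 ^ 2 ⊛ f 1 ^ 1 ⊛ f 4 ^ 1 ⊛ (f 2 ⊛ fInv 2)      ≈⟨ regroup (f 1) (f 2) (f 4) (fInv 2) ⟩
    f 2 ^ 3 ⊛ ψ[-q]                                   ∎))
  where
  open ≈-Reasoning
  regroup : ∀ f₁ f₂ f₄ g → f₂ ^ 2 ⊛ f₁ ^ 1 ⊛ f₄ ^ 1 ⊛ (f₂ ⊛ g) ≈ f₂ ^ 3 ⊛ (f₁ ⊛ f₄ ⊛ g)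
  regroup = solve 4 (λ f₁ f₂ f₄ g → f₂ :^ 2 :* f₁ :^ 1 :* f₄ :^ 1 :* (f₂ :* g) := f₂ :^ 3 :* (f₁ :* f₄ :* g)) ≈-refl
  e₁ : ∀ D K → + 3 ℤ.* (+ 3 ℤ.* K ℤ.+ + 1) ℤ.- + 2 ℤ.* (+ 3 ℤ.* D ℤ.+ + 5) ≡
               + 3 ℤ.* (+ 3 ℤ.* K ℤ.- + 2 ℤ.* D ℤ.- + 3) ℤ.+ + 2
  e₁ = ℤSolver.solve-∀
  e₂ : ∀ K → ℤ.- (+ 2 ℤ.* (+ 3 ℤ.* K ℤ.+ + 1)) ≡ + 3 ℤ.* ℤ.- (+ 2 ℤ.* K ℤ.+ + 1) ℤ.+ + 1
  e₂ = ℤSolver.solve-∀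
  e₃ : ∀ D K → + 3 ℤ.* D ℤ.+ + 5 ℤ.- (+ 3 ℤ.* K ℤ.+ + 1) ≡ + 3 ℤ.* (D ℤ.- K ℤ.+ + 1) ℤ.+ + 1
  e₃ = ℤSolver.solve-∀

[3n+r]%3 : ∀ n r → (3 * n + r) % 3 ≡ r % 3
[3n+r]%3 n r = trans (cong (_% 3) (trans (ℕP.+-comm (3 * n) r) (cong (_+_ r) (ℕP.*-comm 3 n)))) ([m+kn]%n≡m%n r n 3)

theorem1p7 : (n k j : ℕ) → j ≤ k →
    ((+ 3) ∣ abar (3 * (k ∸ j) + 3) (3 * k + 6) (3 * n + 1))
    × ((+ 3) ∣ abar (3 * (k ∸ j) + 3) (3 * k + 6) (3 * n + 2))
    × ((+ 3) ∣ abar (3 * (k ∸ j) + 5) (3 * k + 1) (3 * n + 2))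
-- Only d = k ∸ j enters.
theorem1p7 n k j _ =
    Signed.∣⇒∣ᵤ (3∣coeff (abar[3d+3,3k+6]-InQ³ d k) (3 * n + 1) (1≢0 ∘ trans (sym ([3n+r]%3 n 1))))
  , Signed.∣⇒∣ᵤ (3∣coeff (abar[3d+3,3k+6]-InQ³ d k) (3 * n + 2) (2≢0 ∘ trans (sym ([3n+r]%3 n 2))))
  , Signed.∣⇒∣ᵤ (3∣coeffAt (∼₃-3∣CoeffsAt (abar[3d+5,3k+1]∼₃ψ[-q] d k) 3∣CoeffsAt-ψ[-q])
                           (3 * n + 2) ([3n+r]%3 n 2))
  where
  d = k ∸ j
  1≢0 : 1 ≢ 0
  1≢0 ()
  2≢0 : 2 ≢ 0
  2≢0 ()
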